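{- Let $F$ be either $\mathbb{Z}/m\mathbb{Z}$ (for a positive integer $m$) or $\mathbb{Q}$, let $M$ be an $F$-module, $s$ a positive integer, $A=\{a_1,\dots,a_k\}\subset M$ with $\operatorname{card}(A)=k\ge1$, and let $A_{r,s}=\{\bar e_1,\dots,\bar e_k\}$ be as defined below. Then the rank of the submodule $H_A=\langle \bar e_2-\bar e_1,\dots,\bar e_k-\bar e_1\rangle$ of $\langle A_{r,s}\rangle$ equals $r_s(A)=r(\langle A_{r,s}\rangle)-1$.
   Context: Let $e_1,\dots,e_k$ be the canonical basis of $F^k$, $\phi:F^k\to M$ the $F$-linear map with $\phi(e_i)=a_i$, $R_s\subset F^k$ the set of elements $e_{i_1}+\dots+e_{i_s}-e_{j_1}-\dots-e_{j_s}$ (indices not necessarily distinct), $R_s(A)=R_s\cap\ker\phi$, $\langle X\rangle$ the $F$-submodule generated by $X$, and $\bar e_i$ the image of $e_i$ in $F^k/\langle R_s(A)\rangle$. The rank $r(H)$ of an $F$-module $H$ is the least nonnegative integer $r$ with a surjective $F$-linear map $F^r\to H$. A Freiman $s$-homomorphism between subsets of abelian groups is a map $\psi$ with $a_1+\dots+a_s=a_1'+\dots+a_s'\Rightarrow\psi(a_1)+\dots+\psi(a_s)=\psi(a_1')+\dots+\psi(a_s')$; $\mathrm{Hom}_s(B,F)$ is the $F$-module of Freiman $s$-homomorphisms $B\to F$; the Freiman $s$-rank is $r_s(B)=r(\mathrm{Hom}_s(B,F))-1$. -}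

module Defs where

open import Level using (Level; 0ℓ; _⊔_)
open import Data.Nat as ℕ using (ℕ; zero; suc; _≤_)
open import Data.Integer as ℤ using (ℤ; +_)
open import Data.Integer.Properties as ℤP using ()
open import Data.Integer.Tactic.RingSolver using (solve-∀)
import Data.Rational.Properties as ℚP
open import Data.Fin using (Fin; zero; suc)
open import Data.Fin.Properties using () renaming (_≟_ to _≟ᶠ_)
open import Data.Product using (Σ; ∃; _×_; _,_)
open import Relation.Nullary using (yes; no)
open import Relation.Binary.PropositionalEquality as P using (_≡_; refl)
open import Algebra.Bundles using (CommutativeRing)
open import Algebra.Module.Bundles using (Module)

module ZMod (m : ℕ) where

  infix 4 _≈_
  _≈_ : ℤ → ℤ → Set
  x ≈ y = ∃ λ q → x ℤ.- y ≡ q ℤ.* + m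

  private
    M = + m
    L-refl : ∀ x M → x ℤ.- x ≡ (+ 0) ℤ.* M
    L-refl = solve-∀
    L-neg : ∀ x y → y ℤ.- x ≡ ℤ.- (x ℤ.- y)
    L-neg = solve-∀
    L-negm : ∀ q M → ℤ.- (q ℤ.* M) ≡ (ℤ.- q) ℤ.* M
    L-negm = solve-∀
    L-summ : ∀ q r M → q ℤ.* M ℤ.+ r ℤ.* M ≡ (q ℤ.+ r) ℤ.* M
    L-summ = solve-∀
    L-trans : ∀ x y z → x ℤ.- z ≡ (x ℤ.- y) ℤ.+ (y ℤ.- z)
    L-trans = solve-∀
    L-plus : ∀ x y u v → (x ℤ.+ u) ℤ.- (y ℤ.+ v) ≡ (x ℤ.- y) ℤ.+ (u ℤ.- v)
    L-plus = solve-∀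
    L-negc : ∀ x y → ℤ.- x ℤ.- ℤ.- y ≡ ℤ.- (x ℤ.- y)
    L-negc = solve-∀
    L-mul : ∀ x y u v → x ℤ.* u ℤ.- y ℤ.* v ≡ (x ℤ.- y) ℤ.* u ℤ.+ y ℤ.* (u ℤ.- v)
    L-mul = solve-∀
    L-mul2 : ∀ q u y r M → (q ℤ.* M) ℤ.* u ℤ.+ y ℤ.* (r ℤ.* M) ≡ (q ℤ.* u ℤ.+ y ℤ.* r) ℤ.* M
    L-mul2 = solve-∀
    two : ∀ {a b} q r → a ≡ q ℤ.* M → b ≡ r ℤ.* M → a ℤ.+ b ≡ (q ℤ.+ r) ℤ.* M
    two q r e f = P.trans (P.cong₂ ℤ._+_ e f) (L-summ q r M)

  ≈-refl : ∀ {x} → x ≈ x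
  ≈-refl {x} = + 0 , L-refl x M

  ≡⇒≈ : ∀ {x y} → x ≡ y → x ≈ y
  ≡⇒≈ {x} refl = ≈-refl {x}

  ≈-sym : ∀ {x y} → x ≈ y → y ≈ x
  ≈-sym {x} {y} (q , e) = ℤ.- q , P.trans (L-neg x y) (P.trans (P.cong ℤ.-_ e) (L-negm q M))

  ≈-trans : ∀ {x y z} → x ≈ y → y ≈ z → x ≈ z
  ≈-trans {x} {y} {z} (q , e) (r , f) = q ℤ.+ r , P.trans (L-trans x y z) (two q r e f)

  +-cong : ∀ {x y u v} → x ≈ y → u ≈ v → (x ℤ.+ u) ≈ (y ℤ.+ v)
  +-cong {x} {y} {u} {v} (q , e) (r , f) = q ℤ.+ r , P.trans (L-plus x y u v) (two q r e f)

  neg-cong : ∀ {x y} → x ≈ y → ℤ.- x ≈ ℤ.- y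
  neg-cong {x} {y} (q , e) = ℤ.- q , P.trans (L-negc x y) (P.trans (P.cong ℤ.-_ e) (L-negm q M))

  *-cong : ∀ {x y u v} → x ≈ y → u ≈ v → (x ℤ.* u) ≈ (y ℤ.* v)
  *-cong {x} {y} {u} {v} (q , e) (r , f) =
    q ℤ.* u ℤ.+ y ℤ.* r ,
    P.trans (L-mul x y u v)
      (P.trans (P.cong₂ (λ a b → a ℤ.* u ℤ.+ y ℤ.* b) e f) (L-mul2 q u y r M))

  commutativeRing : CommutativeRing 0ℓ 0ℓ
  commutativeRing = record
    { Carrier = ℤ
    ; _≈_ = _≈_
    ; _+_ = ℤ._+_
    ; _*_ = ℤ._*_
    ; -_ = ℤ.-_
    ; 0# = + 0
    ; 1# = + 1
    ; isCommutativeRing = record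
      { isRing = record
        { +-isAbelianGroup = record
          { isGroup = record
            { isMonoid = record
              { isSemigroup = record
                { isMagma = record
                  { isEquivalence = record { refl = λ {x} → ≈-refl {x} ; sym = λ {x} {y} → ≈-sym {x} {y} ; trans = λ {x} {y} {z} → ≈-trans {x} {y} {z} }
                  ; ∙-cong = λ {x} {y} {u} {v} → +-cong {x} {y} {u} {v} }
                ; assoc = λ x y z → ≡⇒≈ (ℤP.+-assoc x y z) }
              ; identity = (λ x → ≡⇒≈ (ℤP.+-identityˡ x)) , (λ x → ≡⇒≈ (ℤP.+-identityʳ x)) }
            ; inverse = (λ x → ≡⇒≈ (ℤP.+-inverseˡ x)) , (λ x → ≡⇒≈ (ℤP.+-inverseʳ x))
            ; ⁻¹-cong = λ {x} {y} → neg-cong {x} {y} }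
          ; comm = λ x y → ≡⇒≈ (ℤP.+-comm x y) }
        ; *-cong = λ {x} {y} {u} {v} → *-cong {x} {y} {u} {v}
        ; *-assoc = λ x y z → ≡⇒≈ (ℤP.*-assoc x y z)
        ; *-identity = (λ x → ≡⇒≈ (ℤP.*-identityˡ x)) , (λ x → ≡⇒≈ (ℤP.*-identityʳ x))
        ; distrib = (λ x y z → ≡⇒≈ (ℤP.*-distribˡ-+ x y z)) , (λ x y z → ≡⇒≈ (ℤP.*-distribʳ-+ x y z))
        }
      ; *-comm = λ x y → ≡⇒≈ (ℤP.*-comm x y)
      }
    }

data FieldChoice : Set where
  ℤ/_ℤ : (m : ℕ) → .(1≤m : 1 ≤ m) → FieldChoice
  ℚ    : FieldChoice

Ring : FieldChoice → CommutativeRing 0ℓ 0ℓ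
Ring (ℤ/ m ℤ _) = ZMod.commutativeRing m
Ring ℚ          = ℚP.+-*-commutativeRing

module Setup {c ℓ} (F : CommutativeRing c ℓ) where
  open CommutativeRing F using (Carrier; _≈_; _+_; _-_; _*_; 0#; 1#)

  Vecᶠ : ℕ → Set c
  Vecᶠ k = Fin k → Carrier

  _≈v_ : ∀ {k} → Vecᶠ k → Vecᶠ k → Set ℓ
  x ≈v y = ∀ i → x i ≈ y i

  _⊕_ : ∀ {k} → Vecᶠ k → Vecᶠ k → Vecᶠ k
  (x ⊕ y) i = x i + y i

  _⊖_ : ∀ {k} → Vecᶠ k → Vecᶠ k → Vecᶠ k
  (x ⊖ y) i = x i - y i

  _•_ : ∀ {k} → Carrier → Vecᶠ k → Vecᶠ k
  (a • x) i = a * x i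

  0v : ∀ {k} → Vecᶠ k
  0v _ = 0#

  e : ∀ {k} → Fin k → Vecᶠ k
  e i j with i ≟ᶠ j
  ... | yes _ = 1#
  ... | no  _ = 0#

  ΣF : ∀ {n} → (Fin n → Carrier) → Carrier
  ΣF {zero}  f = 0#
  ΣF {suc n} f = f zero + ΣF (λ t → f (suc t))

  ΣV : ∀ {n k} → (Fin n → Vecᶠ k) → Vecᶠ k
  ΣV {zero}  f = 0v
  ΣV {suc n} f = f zero ⊕ ΣV (λ t → f (suc t))

  Span : ∀ {p k} → (Vecᶠ k → Set p) → Vecᶠ k → Set (c ⊔ ℓ ⊔ p)
  Span {k = k} X y = ∃ λ (n : ℕ) → Σ (Fin n → Carrier) λ λs → Σ (Fin n → Vecᶠ k) λ g →
    (∀ t → X (g t)) × (y ≈v ΣV (λ t → λs t • g t))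

  -- R_s: elements e_{i_1}+…+e_{i_s} − e_{j_1}−…−e_{j_s}
  relVec : ∀ {s k} → (Fin s → Fin k) → (Fin s → Fin k) → Vecᶠ k
  relVec i j = ΣV (λ t → e (i t)) ⊖ ΣV (λ t → e (j t))

  InR : ∀ (s : ℕ) {k} → Vecᶠ k → Set ℓ
  InR s {k} x = Σ (Fin s → Fin k) λ i → Σ (Fin s → Fin k) λ j → x ≈v relVec i j

  -- a surjective F-linear map F^r → H, where H ⊆ F^k/~ is the subset P
  -- (P a predicate on representatives, ~ the equality of the ambient module)
  record SurjLin (r : ℕ) {k : ℕ} {p q : Level}
                 (_~_ : Vecᶠ k → Vecᶠ k → Set q) (P : Vecᶠ k → Set p)
                 : Set (c ⊔ ℓ ⊔ p ⊔ q) where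
    field
      f        : Vecᶠ r → Vecᶠ k
      f-cong   : ∀ {x y} → x ≈v y → f x ~ f y
      f-+      : ∀ x y → f (x ⊕ y) ~ (f x ⊕ f y)
      f-•      : ∀ a x → f (a • x) ~ (a • f x)
      f-into   : ∀ x → P (f x)
      f-onto   : ∀ y → P y → ∃ λ x → f x ~ y

  HasRank : ∀ {k p q} → (Vecᶠ k → Vecᶠ k → Set q) → (Vecᶠ k → Set p) → ℕ
            → Set (c ⊔ ℓ ⊔ p ⊔ q)
  HasRank _~_ P r = SurjLin r _~_ P × (∀ r′ → SurjLin r′ _~_ P → r ≤ r′)

  module WithModule {m ℓm} (M : Module F m ℓm) where
    open Module M using (Carrierᴹ; _≈ᴹ_; _+ᴹ_; 0ᴹ; _*ₗ_)

    ΣM : ∀ {n} → (Fin n → Carrierᴹ) → Carrierᴹ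
    ΣM {zero}  f = 0ᴹ
    ΣM {suc n} f = f zero +ᴹ ΣM (λ t → f (suc t))

    module WithSet (s : ℕ) {k : ℕ} (a : Fin k → Carrierᴹ) where

      φ : Vecᶠ k → Carrierᴹ
      φ x = ΣM (λ i → x i *ₗ a i)

      InRA : Vecᶠ k → Set (ℓ ⊔ ℓm)
      InRA x = InR s x × (φ x ≈ᴹ 0ᴹ)

      -- equality in F^k / ⟨R_s(A)⟩ (on representatives)
      _~_ : Vecᶠ k → Vecᶠ k → Set (c ⊔ ℓ ⊔ ℓm)
      x ~ y = Span InRA (x ⊖ y)

      Gen : ∀ {n} → (Fin n → Vecᶠ k) → Vecᶠ k → Set (c ⊔ ℓ ⊔ ℓm)
      Gen g x = Σ (Fin _ → Carrier) λ λs → x ~ ΣV (λ t → λs t • g t)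

      -- ⟨A_{r,s}⟩ = ⟨ ē_1, …, ē_k ⟩
      InAgen : Vecᶠ k → Set (c ⊔ ℓ ⊔ ℓm)
      InAgen = Gen e

      -- Freiman s-homomorphisms A → F, a map ψ : A → F being recorded
      -- through its values ψ(a_i) (A = {a_1,…,a_k} with the a_i distinct)
      IsFreimanHom : Vecᶠ k → Set (ℓ ⊔ ℓm)
      IsFreimanHom ψ = ∀ (i j : Fin s → Fin k) →
        ΣM (λ t → a (i t)) ≈ᴹ ΣM (λ t → a (j t)) →
        ΣF (λ t → ψ (i t)) ≈ ΣF (λ t → ψ (j t))

    -- H_A = ⟨ ē_2 − ē_1, …, ē_k − ē_1 ⟩ (here k = suc n)
    module WithSetSuc (s : ℕ) {n : ℕ} (a : Fin (suc n) → Carrierᴹ) where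
      open WithSet s a public
      InH : Vecᶠ (suc n) → Set (c ⊔ ℓ ⊔ ℓm)
      InH = Gen (λ (t : Fin n) → e (suc t) ⊖ e zero)

module Submission where

-- Let V = ⟨R_s(A)⟩ ⊆ F^k.  Then ⟨A_{r,s}⟩ is F^k/V, H_A is the kernel of the
-- coordinate-sum functional on it (which is 1 at ē₁), and the Freiman
-- s-homomorphisms A → F are the functionals vanishing on V (its dual V^⊥).
-- The theorem thus follows from two facts about F^k/V for finitely generated V:
-- (KernelRank) the kernel of a functional taking the value 1 has rank one
-- less, and (Duality) F^k/V and V^⊥ have equal rank.  Both rest on a Smith
-- normal form for spans, proved for rings with a Euclidean size in which F/dF
-- and Ann(d) are linear images of each other (RingHypotheses); ℤ/mℤ and ℚ are
-- shown to be such rings at the end.  A finite generating family of V needs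
-- the undecidable membership in ker φ, so it is obtained under a double
-- negation, which the decidable goal (an equation in ℕ) absorbs.

open import Defs
open import Data.Nat using (ℕ; suc; _≤_; _∸_)
open import Data.Fin using (Fin)
open import Data.Product using (_×_)
open import Relation.Binary.PropositionalEquality using (_≡_)
open import Level using (0ℓ)
open import Algebra.Bundles using (CommutativeRing)
open import Algebra.Module.Bundles using (Module)

-- Every commutative ring receives the canonical map ℤ → F; it is a ring
-- homomorphism, so the standard ring solver can normalise polynomial
-- identities in F with integer coefficients (needed for constants such
-- as 0 = -1 + 1, which a solver with opaque F-coefficients cannot see).
module IntegerSolver (F : CommutativeRing 0ℓ 0ℓ) where

  open import Algebra.Bundles using (RawRing)
  open import Data.Maybe using (Maybe; just; nothing)
  open import Data.Nat as ℕ using (ℕ; zero; suc)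
  open import Data.Integer as ℤ using (ℤ; +_; -[1+_])
  import Data.Integer.Properties as ℤP
  open import Data.Sign as Sign using (Sign)
  open import Relation.Nullary using (yes; no)
  import Relation.Binary.PropositionalEquality as P
  import Algebra.Solver.Ring as RingSolver
  open import Algebra.Solver.Ring.AlmostCommutativeRing
    using (AlmostCommutativeRing; fromCommutativeRing; _-Raw-AlmostCommutative⟶_)

  open CommutativeRing F
  open import Algebra.Properties.Ring ring using (-‿involutive; -‿distribˡ-*; -1*x≈-x; -0#≈0#)
  open import Algebra.Properties.AbelianGroup +-abelianGroup using (⁻¹-∙-comm)
  open import Algebra.Properties.Monoid.Mult.TCOptimised +-monoid using (×-homo-+) renaming (_×_ to _×ₙ_)
  open import Algebra.Properties.Semiring.Mult.TCOptimised semiring using (×1-homo-*)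
  open import Relation.Binary.Reasoning.Setoid setoid

  -- ν n = n · 1, the image of a natural number (with ν 1 = 1# definitionally,
  -- as the solver requires)
  ν : ℕ → Carrier
  ν n = n ×ₙ 1#

  ν-suc : ∀ n → ν (suc n) ≈ 1# + ν n
  ν-suc n = ×-homo-+ 1# 1 n

  ⟦_⟧ᶻ : ℤ → Carrier
  ⟦ + n ⟧ᶻ = ν n
  ⟦ -[1+ n ] ⟧ᶻ = - ν (suc n)

  neg-distrib-+ : ∀ x y → - (x + y) ≈ - x + - y
  neg-distrib-+ x y = sym (⁻¹-∙-comm x y)

  ⊖-homo : ∀ m n → ⟦ m ℤ.⊖ n ⟧ᶻ ≈ ν m - ν n
  ⊖-homo zero zero = sym (-‿inverseʳ 0#)
  ⊖-homo zero (suc n) = sym (+-identityˡ _)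
  ⊖-homo (suc m) zero = sym (trans (+-congˡ -0#≈0#) (+-identityʳ _))
  ⊖-homo (suc m) (suc n) = begin
    ⟦ suc m ℤ.⊖ suc n ⟧ᶻ      ≡⟨ P.cong ⟦_⟧ᶻ (ℤP.[1+m]⊖[1+n]≡m⊖n m n) ⟩
    ⟦ m ℤ.⊖ n ⟧ᶻ              ≈⟨ ⊖-homo m n ⟩
    ν m - ν n                 ≈⟨ shift (ν m) (ν n) ⟩
    (1# + ν m) - (1# + ν n)   ≈⟨ sym (+-cong (ν-suc m) (-‿cong (ν-suc n))) ⟩
    ν (suc m) - ν (suc n)     ∎
    where
      shift : ∀ a b → a - b ≈ (1# + a) - (1# + b)
      shift a b = begin
        a - b                         ≈⟨ sym (+-identityʳ _) ⟩
        (a - b) + 0#                  ≈⟨ +-congˡ (sym (-‿inverseˡ 1#)) ⟩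
        (a - b) + (- 1# + 1#)         ≈⟨ +-assoc a (- b) _ ⟩
        a + (- b + (- 1# + 1#))       ≈⟨ +-congˡ (trans (sym (+-assoc _ _ _)) (+-comm _ 1#)) ⟩
        a + (1# + (- b + - 1#))       ≈⟨ sym (+-assoc _ _ _) ⟩
        (a + 1#) + (- b + - 1#)       ≈⟨ +-cong (+-comm a 1#) (trans (+-comm _ _) (⁻¹-∙-comm 1# b)) ⟩
        (1# + a) - (1# + b)           ∎

  -homo : ∀ i → ⟦ ℤ.- i ⟧ᶻ ≈ - ⟦ i ⟧ᶻ
  -homo (+ zero) = sym -0#≈0#
  -homo (+ suc n) = refl
  -homo -[1+ n ] = sym (-‿involutive _)

  +-homo : ∀ i j → ⟦ i ℤ.+ j ⟧ᶻ ≈ ⟦ i ⟧ᶻ + ⟦ j ⟧ᶻ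
  +-homo -[1+ m ] -[1+ n ] = begin
    - ν (suc (suc (m ℕ.+ n)))          ≈⟨ -‿cong (trans (ν-suc (suc (m ℕ.+ n))) (+-congˡ (trans (ν-suc (m ℕ.+ n)) (+-congˡ (×-homo-+ 1# m n))))) ⟩
    - (1# + (1# + (ν m + ν n)))        ≈⟨ -‿cong (+-congˡ (trans (sym (+-assoc _ _ _)) (trans (+-congʳ (+-comm _ _)) (+-assoc _ _ _)))) ⟩
    - (1# + (ν m + (1# + ν n)))        ≈⟨ -‿cong (sym (+-assoc _ _ _)) ⟩
    - ((1# + ν m) + (1# + ν n))        ≈⟨ -‿cong (sym (+-cong (ν-suc m) (ν-suc n))) ⟩
    - (ν (suc m) + ν (suc n))          ≈⟨ neg-distrib-+ _ _ ⟩
    - ν (suc m) + - ν (suc n)          ∎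
  +-homo -[1+ m ] (+ n) = trans (⊖-homo n (suc m)) (+-comm _ _)
  +-homo (+ m) -[1+ n ] = ⊖-homo m (suc n)
  +-homo (+ m) (+ n) = ×-homo-+ 1# m n

  σ : Sign → Carrier
  σ Sign.+ = 1#
  σ Sign.- = - 1#

  ◃-homo : ∀ s n → ⟦ s ℤ.◃ n ⟧ᶻ ≈ σ s * ν n
  ◃-homo s zero = sym (zeroʳ _)
  ◃-homo Sign.+ (suc n) = sym (*-identityˡ _)
  ◃-homo Sign.- (suc n) = sym (-1*x≈-x _)

  sign-homo : ∀ i → ⟦ i ⟧ᶻ ≈ σ (ℤ.sign i) * ν ℤ.∣ i ∣
  sign-homo (+ n) = sym (*-identityˡ _)
  sign-homo -[1+ n ] = sym (-1*x≈-x _)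

  σ-* : ∀ s t → σ (s Sign.* t) ≈ σ s * σ t
  σ-* Sign.+ Sign.+ = sym (*-identityˡ _)
  σ-* Sign.+ Sign.- = sym (*-identityˡ _)
  σ-* Sign.- Sign.+ = sym (*-identityʳ _)
  σ-* Sign.- Sign.- = sym (trans (sym (-‿distribˡ-* 1# (- 1#))) (trans (-‿cong (*-identityˡ _)) (-‿involutive 1#)))

  *-homo : ∀ i j → ⟦ i ℤ.* j ⟧ᶻ ≈ ⟦ i ⟧ᶻ * ⟦ j ⟧ᶻ
  *-homo i j = begin
    ⟦ i ℤ.* j ⟧ᶻ                                         ≈⟨ ◃-homo (sᵢ Sign.* sⱼ) (∣i∣ ℕ.* ∣j∣) ⟩
    σ (sᵢ Sign.* sⱼ) * ν (∣i∣ ℕ.* ∣j∣)                   ≈⟨ *-cong (σ-* sᵢ sⱼ) (×1-homo-* ∣i∣ ∣j∣) ⟩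
    (σ sᵢ * σ sⱼ) * (ν ∣i∣ * ν ∣j∣)                      ≈⟨ middle-swap (σ sᵢ) (σ sⱼ) (ν ∣i∣) (ν ∣j∣) ⟩
    (σ sᵢ * ν ∣i∣) * (σ sⱼ * ν ∣j∣)                      ≈⟨ *-cong (sym (sign-homo i)) (sym (sign-homo j)) ⟩
    ⟦ i ⟧ᶻ * ⟦ j ⟧ᶻ                                       ∎
    where
      sᵢ = ℤ.sign i
      sⱼ = ℤ.sign j
      ∣i∣ = ℤ.∣ i ∣
      ∣j∣ = ℤ.∣ j ∣
      middle-swap : ∀ a b c d → (a * b) * (c * d) ≈ (a * c) * (b * d)
      middle-swap a b c d = begin
        (a * b) * (c * d)   ≈⟨ *-assoc a b _ ⟩
        a * (b * (c * d))   ≈⟨ *-congˡ (trans (sym (*-assoc b c d)) (trans (*-congʳ (*-comm b c)) (*-assoc c b d))) ⟩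
        a * (c * (b * d))   ≈⟨ sym (*-assoc a c _) ⟩
        (a * c) * (b * d)   ∎

  ℤ-rawRing : RawRing 0ℓ 0ℓ
  ℤ-rawRing = record
    { Carrier = ℤ ; _≈_ = P._≡_ ; _+_ = ℤ._+_ ; _*_ = ℤ._*_ ; -_ = ℤ.-_ ; 0# = + 0 ; 1# = + 1 }

  ℤ⟶F : ℤ-rawRing -Raw-AlmostCommutative⟶ fromCommutativeRing F
  ℤ⟶F = record
    { ⟦_⟧ = ⟦_⟧ᶻ ; +-homo = +-homo ; *-homo = *-homo ; -‿homo = -homo ; 0-homo = refl ; 1-homo = refl }

  coefficient-test : ∀ a b → Maybe (⟦ a ⟧ᶻ ≈ ⟦ b ⟧ᶻ)
  coefficient-test a b with a ℤ.≟ b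
  ... | yes P.refl = just refl
  ... | no _ = nothing

  module Sol = RingSolver ℤ-rawRing (fromCommutativeRing F) ℤ⟶F coefficient-test


module Vectors (F : CommutativeRing 0ℓ 0ℓ) where

  open import Data.Nat using (ℕ; zero; suc)
  open import Data.Fin using (Fin; zero; suc)
  open import Data.Fin.Properties using (suc-injective) renaming (_≟_ to _≟ᶠ_)
  open import Data.Product using (Σ; _,_)
  open import Data.Vec.Functional using (_∷_; tail) public
  open import Relation.Nullary using (Dec; yes; no)
  open import Relation.Binary.PropositionalEquality as P using (_≡_; _≢_)
  open import Data.Empty using (⊥-elim)
  open import Defs using (module Setup)

  open CommutativeRing F public hiding (zero)
  open Setup F public
  open import Algebra.Properties.Ring ring using (-1*x≈-x; -0#≈0#) public
  open import Relation.Binary.Reasoning.Setoid setoid public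
  open IntegerSolver F using (module Sol) public

  ≈v-refl : ∀ {k} {x : Vecᶠ k} → x ≈v x
  ≈v-refl i = refl
  ≈v-sym : ∀ {k} {x y : Vecᶠ k} → x ≈v y → y ≈v x
  ≈v-sym p i = sym (p i)
  ≈v-trans : ∀ {k} {x y z : Vecᶠ k} → x ≈v y → y ≈v z → x ≈v z
  ≈v-trans p q i = trans (p i) (q i)

  ⊕-cong : ∀ {k} {x y u v : Vecᶠ k} → x ≈v y → u ≈v v → (x ⊕ u) ≈v (y ⊕ v)
  ⊕-cong p q i = +-cong (p i) (q i)
  •-cong : ∀ {k} {a b} {x y : Vecᶠ k} → a ≈ b → x ≈v y → (a • x) ≈v (b • y)
  •-cong p q i = *-cong p (q i)
  ⊖-cong : ∀ {k} {x y u v : Vecᶠ k} → x ≈v y → u ≈v v → (x ⊖ u) ≈v (y ⊖ v)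
  ⊖-cong p q i = +-cong (p i) (-‿cong (q i))

  x-y≈0⇒x≈y : ∀ {a b} → a - b ≈ 0# → a ≈ b
  x-y≈0⇒x≈y {a} {b} p = begin
    a              ≈⟨ sym (+-identityʳ a) ⟩
    a + 0#         ≈⟨ +-congˡ (sym (-‿inverseˡ b)) ⟩
    a + (- b + b)  ≈⟨ sym (+-assoc a (- b) b) ⟩
    (a - b) + b    ≈⟨ +-congʳ p ⟩
    0# + b         ≈⟨ +-identityˡ b ⟩
    b              ∎
  x≈y⇒x-y≈0 : ∀ {a b} → a ≈ b → a - b ≈ 0#
  x≈y⇒x-y≈0 {a} {b} p = trans (+-congʳ p) (-‿inverseʳ b)

  ΣF-cong : ∀ {n} {f g : Fin n → Carrier} → (∀ i → f i ≈ g i) → ΣF f ≈ ΣF g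
  ΣF-cong {zero} p = refl
  ΣF-cong {suc n} p = +-cong (p zero) (ΣF-cong (λ i → p (suc i)))

  ΣF-+ : ∀ {n} (f g : Fin n → Carrier) → ΣF (λ i → f i + g i) ≈ ΣF f + ΣF g
  ΣF-+ {zero} f g = sym (+-identityˡ 0#)
  ΣF-+ {suc n} f g = trans (+-congˡ (ΣF-+ (tail f) (tail g)))
    (solve 4 (λ a b c d → (a :+ b) :+ (c :+ d) := (a :+ c) :+ (b :+ d)) refl _ _ _ _)
    where open Sol

  ΣF-* : ∀ {n} (c : Carrier) (f : Fin n → Carrier) → ΣF (λ i → c * f i) ≈ c * ΣF f
  ΣF-* {zero} c f = sym (zeroʳ c)
  ΣF-* {suc n} c f = trans (+-congˡ (ΣF-* c (tail f))) (sym (distribˡ c _ _))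

  ΣF-0 : ∀ {n} (f : Fin n → Carrier) → (∀ i → f i ≈ 0#) → ΣF f ≈ 0#
  ΣF-0 {zero} f p = refl
  ΣF-0 {suc n} f p = trans (+-cong (p zero) (ΣF-0 (tail f) (λ i → p (suc i)))) (+-identityˡ 0#)

  ΣF-neg : ∀ {n} (f : Fin n → Carrier) → ΣF (λ i → - f i) ≈ - ΣF f
  ΣF-neg f = begin
    ΣF (λ i → - f i)        ≈⟨ ΣF-cong {f = λ i → - f i} (λ i → sym (-1*x≈-x (f i))) ⟩
    ΣF (λ i → - 1# * f i)   ≈⟨ ΣF-* (- 1#) f ⟩
    - 1# * ΣF f             ≈⟨ -1*x≈-x _ ⟩
    - ΣF f                  ∎

  ΣV-app : ∀ {n k} (f : Fin n → Vecᶠ k) (i : Fin k) → ΣV f i ≈ ΣF (λ t → f t i)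
  ΣV-app {zero} f i = refl
  ΣV-app {suc n} f i = +-congˡ (ΣV-app (tail f) i)

  ΣV-cong : ∀ {n k} {f g : Fin n → Vecᶠ k} → (∀ t → f t ≈v g t) → ΣV f ≈v ΣV g
  ΣV-cong {f = f} {g} p i = trans (ΣV-app f i) (trans (ΣF-cong (λ t → p t i)) (sym (ΣV-app g i)))

  ΣV-⊕ : ∀ {n k} (f g : Fin n → Vecᶠ k) → ΣV (λ t → f t ⊕ g t) ≈v (ΣV f ⊕ ΣV g)
  ΣV-⊕ f g i = trans (ΣV-app (λ t → f t ⊕ g t) i)
    (trans (ΣF-+ (λ t → f t i) (λ t → g t i)) (sym (+-cong (ΣV-app f i) (ΣV-app g i))))

  ΣV-• : ∀ {n k} a (f : Fin n → Vecᶠ k) → ΣV (λ t → a • f t) ≈v (a • ΣV f)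
  ΣV-• a f i = trans (ΣV-app (λ t → a • f t) i)
    (trans (ΣF-* a (λ t → f t i)) (sym (*-congˡ (ΣV-app f i))))

  ΣV-0 : ∀ {n k} (f : Fin n → Vecᶠ k) → (∀ t → f t ≈v 0v) → ΣV f ≈v 0v
  ΣV-0 f p i = trans (ΣV-app f i) (ΣF-0 (λ t → f t i) (λ t → p t i))

  e-same : ∀ {k} (i : Fin k) → e i i ≈ 1#
  e-same i with i ≟ᶠ i
  ... | yes _ = refl
  ... | no i≢i = ⊥-elim (i≢i P.refl)

  e-diff : ∀ {k} {i j : Fin k} → i ≢ j → e i j ≈ 0#
  e-diff {i = i} {j} i≢j with i ≟ᶠ j
  ... | yes i≡j = ⊥-elim (i≢j i≡j)
  ... | no _ = refl

  e-sym : ∀ {k} (i j : Fin k) → e i j ≈ e j i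
  e-sym i j = by-cases (i ≟ᶠ j)
    where
      by-cases : Dec (i ≡ j) → e i j ≈ e j i
      by-cases (yes P.refl) = refl
      by-cases (no i≢j) = trans (e-diff i≢j) (sym (e-diff (λ j≡i → i≢j (P.sym j≡i))))

  e-suc : ∀ {k} (i j : Fin k) → e (suc i) (suc j) ≈ e i j
  e-suc i j = by-cases (i ≟ᶠ j)
    where
      by-cases : Dec (i ≡ j) → e (suc i) (suc j) ≈ e i j
      by-cases (yes P.refl) = trans (e-same (suc i)) (sym (e-same i))
      by-cases (no i≢j) = trans (e-diff (λ eq → i≢j (suc-injective eq))) (sym (e-diff i≢j))

  e-0s : ∀ {k} (j : Fin k) → e zero (suc j) ≈ 0#
  e-0s j = e-diff {i = zero} {j = suc j} (λ ())
  e-s0 : ∀ {k} (j : Fin k) → e (suc j) zero ≈ 0#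
  e-s0 j = e-diff {i = suc j} {j = zero} (λ ())

  δ-sum : ∀ {n} (i : Fin n) (f : Fin n → Carrier) → ΣF (λ t → e i t * f t) ≈ f i
  δ-sum {suc n} zero f = begin
    e {suc n} zero zero * f zero + ΣF (λ t → e zero (suc t) * f (suc t))
      ≈⟨ +-cong (trans (*-congʳ (e-same {suc n} zero)) (*-identityˡ _))
                (ΣF-0 (λ t → e zero (suc t) * f (suc t)) (λ t → trans (*-congʳ (e-0s t)) (zeroˡ _))) ⟩
    f zero + 0#  ≈⟨ +-identityʳ _ ⟩
    f zero       ∎
  δ-sum {suc n} (suc i) f = begin
    e (suc i) zero * f zero + ΣF (λ t → e (suc i) (suc t) * f (suc t))
      ≈⟨ +-cong (trans (*-congʳ (e-s0 i)) (zeroˡ _)) (ΣF-cong {f = λ t → e (suc i) (suc t) * f (suc t)} (λ t → *-congʳ (e-suc i t))) ⟩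
    0# + ΣF (λ t → e i t * f (suc t))  ≈⟨ +-identityˡ _ ⟩
    ΣF (λ t → e i t * f (suc t))       ≈⟨ δ-sum i (tail f) ⟩
    f (suc i)                          ∎

  δ-sum' : ∀ {n} (i : Fin n) (f : Fin n → Carrier) → ΣF (λ t → f t * e t i) ≈ f i
  δ-sum' i f = trans (ΣF-cong {f = λ t → f t * e t i} (λ t → trans (*-comm _ _) (*-congʳ (e-sym t i)))) (δ-sum i f)

  expand : ∀ {k} (x : Vecᶠ k) → x ≈v ΣV (λ t → x t • e t)
  expand x i = sym (trans (ΣV-app (λ t → x t • e t) i) (δ-sum' i x))

  ⟨_,_⟩ : ∀ {k} → Vecᶠ k → Vecᶠ k → Carrier
  ⟨ ψ , x ⟩ = ΣF (λ t → ψ t * x t)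

  dot-cong : ∀ {k} {ψ ψ' x x' : Vecᶠ k} → ψ ≈v ψ' → x ≈v x' → ⟨ ψ , x ⟩ ≈ ⟨ ψ' , x' ⟩
  dot-cong {ψ = ψ} {x = x} p q = ΣF-cong {f = λ t → ψ t * x t} (λ t → *-cong (p t) (q t))

  dot-comm : ∀ {k} (ψ x : Vecᶠ k) → ⟨ ψ , x ⟩ ≈ ⟨ x , ψ ⟩
  dot-comm ψ x = ΣF-cong {f = λ t → ψ t * x t} (λ t → *-comm _ _)

  dot-⊕ʳ : ∀ {k} (ψ x y : Vecᶠ k) → ⟨ ψ , x ⊕ y ⟩ ≈ ⟨ ψ , x ⟩ + ⟨ ψ , y ⟩
  dot-⊕ʳ ψ x y = trans (ΣF-cong {f = λ t → ψ t * (x t + y t)} (λ t → distribˡ _ _ _)) (ΣF-+ (λ t → ψ t * x t) (λ t → ψ t * y t))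

  dot-•ʳ : ∀ {k} (ψ : Vecᶠ k) a x → ⟨ ψ , a • x ⟩ ≈ a * ⟨ ψ , x ⟩
  dot-•ʳ ψ a x = trans (ΣF-cong {f = λ t → ψ t * (a * x t)} (λ t → trans (sym (*-assoc _ _ _)) (trans (*-congʳ (*-comm _ _)) (*-assoc _ _ _))))
                       (ΣF-* a (λ t → ψ t * x t))

  dot-⊖ʳ : ∀ {k} (ψ x y : Vecᶠ k) → ⟨ ψ , x ⊖ y ⟩ ≈ ⟨ ψ , x ⟩ - ⟨ ψ , y ⟩
  dot-⊖ʳ ψ x y = begin
    ⟨ ψ , x ⊖ y ⟩                    ≈⟨ dot-cong {ψ = ψ} {x = x ⊖ y} ≈v-refl (λ i → +-congˡ (sym (-1*x≈-x _))) ⟩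
    ⟨ ψ , x ⊕ ((- 1#) • y) ⟩         ≈⟨ dot-⊕ʳ ψ x _ ⟩
    ⟨ ψ , x ⟩ + ⟨ ψ , (- 1#) • y ⟩   ≈⟨ +-congˡ (trans (dot-•ʳ ψ (- 1#) y) (-1*x≈-x _)) ⟩
    ⟨ ψ , x ⟩ - ⟨ ψ , y ⟩            ∎

  dot-⊕ˡ : ∀ {k} (ψ φ x : Vecᶠ k) → ⟨ ψ ⊕ φ , x ⟩ ≈ ⟨ ψ , x ⟩ + ⟨ φ , x ⟩
  dot-⊕ˡ ψ φ x = trans (ΣF-cong {f = λ t → (ψ t + φ t) * x t} (λ t → distribʳ _ _ _)) (ΣF-+ (λ t → ψ t * x t) (λ t → φ t * x t))

  dot-•ˡ : ∀ {k} a (ψ x : Vecᶠ k) → ⟨ a • ψ , x ⟩ ≈ a * ⟨ ψ , x ⟩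
  dot-•ˡ a ψ x = trans (ΣF-cong {f = λ t → (a * ψ t) * x t} (λ t → *-assoc _ _ _)) (ΣF-* a (λ t → ψ t * x t))

  dot-eʳ : ∀ {k} (ψ : Vecᶠ k) i → ⟨ ψ , e i ⟩ ≈ ψ i
  dot-eʳ ψ i = trans (ΣF-cong {f = λ t → ψ t * e i t} (λ t → *-congˡ (e-sym i t))) (δ-sum' i ψ)

  dot-0ʳ : ∀ {k} (ψ : Vecᶠ k) → ⟨ ψ , 0v ⟩ ≈ 0#
  dot-0ʳ ψ = ΣF-0 (λ t → ψ t * 0#) (λ t → zeroʳ _)

  dot-ΣVʳ : ∀ {n k} (ψ : Vecᶠ k) (f : Fin n → Vecᶠ k) → ⟨ ψ , ΣV f ⟩ ≈ ΣF (λ t → ⟨ ψ , f t ⟩)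
  dot-ΣVʳ {zero} ψ f = dot-0ʳ ψ
  dot-ΣVʳ {suc n} ψ f = trans (dot-⊕ʳ ψ (f zero) _) (+-congˡ (dot-ΣVʳ ψ (tail f)))

  SpanF : ∀ {N k} → (Fin N → Vecᶠ k) → Vecᶠ k → Set
  SpanF {N} g x = Σ (Fin N → Carrier) λ λs → x ≈v ΣV (λ t → λs t • g t)

  module _ {N k : ℕ} (g : Fin N → Vecᶠ k) where
    span-resp : ∀ {x y} → x ≈v y → SpanF g x → SpanF g y
    span-resp p (λs , q) = λs , ≈v-trans (≈v-sym p) q

    span-0 : SpanF g 0v
    span-0 = (λ _ → 0#) , ≈v-sym (ΣV-0 (λ t → 0# • g t) (λ t i → zeroˡ _))

    span-⊕ : ∀ {x y} → SpanF g x → SpanF g y → SpanF g (x ⊕ y)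
    span-⊕ (λs , p) (μs , q) = (λ t → λs t + μs t) , ≈v-trans (⊕-cong p q) (≈v-sym (≈v-trans
      (ΣV-cong {f = λ t → (λs t + μs t) • g t} (λ t i → distribʳ _ _ _)) (ΣV-⊕ (λ t → λs t • g t) (λ t → μs t • g t))))

    span-• : ∀ a {x} → SpanF g x → SpanF g (a • x)
    span-• a (λs , p) = (λ t → a * λs t) , ≈v-trans (•-cong refl p) (≈v-sym (≈v-trans
      (ΣV-cong {f = λ t → (a * λs t) • g t} (λ t i → *-assoc _ _ _)) (ΣV-• a (λ t → λs t • g t))))

    span-gen : ∀ t → SpanF g (g t)
    span-gen t = e t , λ i → sym (trans (ΣV-app (λ u → e t u • g u) i) (δ-sum t (λ u → g u i)))

    span-ΣV : ∀ {M} (a : Fin M → Carrier) (f : Fin M → Vecᶠ k) → (∀ t → SpanF g (f t)) →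
              SpanF g (ΣV (λ t → a t • f t))
    span-ΣV {zero} a f p = span-0
    span-ΣV {suc M} a f p = span-⊕ (span-• (a zero) (p zero)) (span-ΣV (tail a) (tail f) (λ t → p (suc t)))

  span-sub : ∀ {N N' k} (g : Fin N → Vecᶠ k) (g' : Fin N' → Vecᶠ k) →
             (∀ t → SpanF g' (g t)) → ∀ {x} → SpanF g x → SpanF g' x
  span-sub g g' p (λs , q) = span-resp g' (≈v-sym q) (span-ΣV g' λs g p)

  record IsLinear {k k'} (h : Vecᶠ k → Vecᶠ k') : Set where
    field
      l-cong : ∀ {x y} → x ≈v y → h x ≈v h y
      l-⊕ : ∀ x y → h (x ⊕ y) ≈v (h x ⊕ h y)
      l-• : ∀ a x → h (a • x) ≈v (a • h x)

  id-lin : ∀ {k} → IsLinear {k} (λ x → x)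
  id-lin = record { l-cong = λ p → p ; l-⊕ = λ x y → ≈v-refl ; l-• = λ a x → ≈v-refl }

  ∘-lin : ∀ {k k' k''} {f : Vecᶠ k → Vecᶠ k'} {g : Vecᶠ k' → Vecᶠ k''} →
          IsLinear f → IsLinear g → IsLinear (λ x → g (f x))
  ∘-lin Lf Lg = record
    { l-cong = λ p → G.l-cong (F'.l-cong p)
    ; l-⊕ = λ x y → ≈v-trans (G.l-cong (F'.l-⊕ x y)) (G.l-⊕ _ _)
    ; l-• = λ a x → ≈v-trans (G.l-cong (F'.l-• a x)) (G.l-• _ _) }
    where module F' = IsLinear Lf
          module G = IsLinear Lg

  module _ {k k'} {h : Vecᶠ k → Vecᶠ k'} (L : IsLinear h) where
    open IsLinear L

    lin-0 : h 0v ≈v 0v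
    lin-0 = ≈v-trans (l-cong {y = 0# • 0v} (λ i → sym (zeroˡ _))) (≈v-trans (l-• 0# 0v) (λ i → zeroˡ _))

    lin-ΣV : ∀ {M} (a : Fin M → Carrier) (f : Fin M → Vecᶠ k) →
             h (ΣV (λ t → a t • f t)) ≈v ΣV (λ t → a t • h (f t))
    lin-ΣV {zero} a f = lin-0
    lin-ΣV {suc M} a f = ≈v-trans (l-⊕ _ _) (⊕-cong (l-• _ _) (lin-ΣV (tail a) (tail f)))

    lin-⊖ : ∀ x y → h (x ⊖ y) ≈v (h x ⊖ h y)
    lin-⊖ x y = ≈v-trans (l-cong {y = x ⊕ ((- 1#) • y)} (λ i → +-congˡ (sym (-1*x≈-x _))))
      (≈v-trans (l-⊕ _ _) (⊕-cong ≈v-refl (≈v-trans (l-• _ _) (λ i → -1*x≈-x _))))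

    span-map : ∀ {N} (g : Fin N → Vecᶠ k) {x} → SpanF g x → SpanF (λ t → h (g t)) (h x)
    span-map g (λs , p) = λs , ≈v-trans (l-cong p) (lin-ΣV λs g)


-- Invertible linear maps of F^k that carry their transposes along
-- (automorphisms "with adjoints"), and the elementary ones among them:
-- a 2×2 invertible matrix acting on the coordinates 0 and j+1.
-- Transposes are kept because the duality argument transports
-- annihilators (ψ with ⟨ψ , v⟩ ≈ 0) along the same change of basis.
module Automorphisms (F : CommutativeRing 0ℓ 0ℓ) where

  open import Data.Nat using (ℕ; suc)
  open import Data.Fin using (Fin; zero; suc)
  open import Data.Fin.Properties using () renaming (_≟_ to _≟ᶠ_)
  open import Data.Integer using (+_)
  open import Data.Product using (_×_; _,_)
  open import Relation.Binary.PropositionalEquality using (_≢_)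
  open Vectors F
  open Sol using (solve; _:+_; _:*_; _:-_; :-_; _:=_; con)

  record M2 : Set where
    constructor m2
    field ma mb mc md : Carrier

  _·M_ : M2 → M2 → M2
  m2 a b c d ·M m2 a' b' c' d' = m2 (a * a' + b * c') (a * b' + b * d') (c * a' + d * c') (c * b' + d * d')

  TrM : M2 → M2
  TrM (m2 a b c d) = m2 a c b d

  IsId : M2 → Set
  IsId (m2 a b c d) = (a ≈ 1#) × (b ≈ 0#) × (c ≈ 0#) × (d ≈ 1#)

  TrM-· : ∀ M N → IsId (M ·M N) → IsId (TrM N ·M TrM M)
  TrM-· (m2 a b c d) (m2 a' b' c' d') (p1 , p2 , p3 , p4) =
    swap p1 , swap p3 , swap p2 , swap p4
    where
      swap : ∀ {u u' v v' w} → u * u' + v * v' ≈ w → u' * u + v' * v ≈ w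
      swap = trans (+-cong (*-comm _ _) (*-comm _ _))

  -- op2 j M replaces (x₀ , x_{j+1}) by M (x₀ , x_{j+1}) and leaves the other
  -- coordinates alone; coordinate i+1 is written x_{i+1} + δ_{ji} (new - old)
  -- so that no case distinction on i is needed.
  op2 : ∀ {k} → Fin k → M2 → Vecᶠ (suc k) → Vecᶠ (suc k)
  op2 j (m2 a b c d) x zero = a * x zero + b * x (suc j)
  op2 j (m2 a b c d) x (suc i) = x (suc i) + e j i * ((c * x zero + d * x (suc j)) - x (suc j))

  op2-at : ∀ {k} (j : Fin k) M x → op2 j M x (suc j) ≈ M2.mc M * x zero + M2.md M * x (suc j)
  op2-at j M x = trans (+-congˡ (trans (*-congʳ (e-same j)) (*-identityˡ _)))
                       (solve 2 (λ X Y → X :+ (Y :- X) := Y) refl (x (suc j)) _)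

  op2-other : ∀ {k} (j : Fin k) M x {i} → j ≢ i → op2 j M x (suc i) ≈ x (suc i)
  op2-other j M x j≢i = trans (+-congˡ (trans (*-congʳ (e-diff j≢i)) (zeroˡ _))) (+-identityʳ _)

  pair-update : ∀ {k} (ψ x : Vecᶠ k) (j : Fin k) (D : Carrier) →
    ΣF (λ i → ψ i * (x i + e j i * D)) ≈ ⟨ ψ , x ⟩ + ψ j * D
  pair-update ψ x j D = begin
    ΣF (λ i → ψ i * (x i + e j i * D))
      ≈⟨ ΣF-cong {f = λ i → ψ i * (x i + e j i * D)}
           (λ i → trans (distribˡ _ _ _) (+-congˡ (solve 3 (λ p E d → p :* (E :* d) := E :* (p :* d)) refl (ψ i) (e j i) D))) ⟩
    ΣF (λ i → ψ i * x i + e j i * (ψ i * D))  ≈⟨ ΣF-+ (λ i → ψ i * x i) (λ i → e j i * (ψ i * D)) ⟩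
    ⟨ ψ , x ⟩ + ΣF (λ i → e j i * (ψ i * D))  ≈⟨ +-congˡ (δ-sum j (λ i → ψ i * D)) ⟩
    ⟨ ψ , x ⟩ + ψ j * D                       ∎

  op2-adj : ∀ {k} (j : Fin k) M (ψ x : Vecᶠ (suc k)) → ⟨ ψ , op2 j M x ⟩ ≈ ⟨ op2 j (TrM M) ψ , x ⟩
  op2-adj j M@(m2 a b c d) ψ x = begin
    ψ₀ * (a * x₀ + b * xⱼ) + ΣF (λ i → ψ (suc i) * (x (suc i) + e j i * ((c * x₀ + d * xⱼ) - xⱼ)))
      ≈⟨ +-congˡ (pair-update (tail ψ) (tail x) j _) ⟩
    ψ₀ * (a * x₀ + b * xⱼ) + (T + ψⱼ * ((c * x₀ + d * xⱼ) - xⱼ))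
      ≈⟨ solve 9 (λ a b c d p0 pj x0 xj T → p0 :* (a :* x0 :+ b :* xj) :+ (T :+ pj :* ((c :* x0 :+ d :* xj) :- xj))
                   := (a :* p0 :+ c :* pj) :* x0 :+ (T :+ ((b :* p0 :+ d :* pj) :- pj) :* xj)) refl a b c d ψ₀ ψⱼ x₀ xⱼ T ⟩
    (a * ψ₀ + c * ψⱼ) * x₀ + (T + ((b * ψ₀ + d * ψⱼ) - ψⱼ) * xⱼ)
      ≈⟨ +-congˡ (trans (+-cong (dot-comm (tail ψ) (tail x)) (*-comm _ _)) (sym (pair-update (tail x) (tail ψ) j _))) ⟩
    (a * ψ₀ + c * ψⱼ) * x₀ + ΣF (λ i → x (suc i) * (ψ (suc i) + e j i * ((b * ψ₀ + d * ψⱼ) - ψⱼ)))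
      ≈⟨ +-congˡ (ΣF-cong {f = λ i → x (suc i) * (ψ (suc i) + e j i * ((b * ψ₀ + d * ψⱼ) - ψⱼ))} (λ i → *-comm _ _)) ⟩
    ⟨ op2 j (TrM M) ψ , x ⟩ ∎
    where
      x₀ = x zero
      xⱼ = x (suc j)
      ψ₀ = ψ zero
      ψⱼ = ψ (suc j)
      T = ΣF (λ i → ψ (suc i) * x (suc i))

  op2-comp : ∀ {k} (j : Fin k) M N x → op2 j M (op2 j N x) ≈v op2 j (M ·M N) x
  op2-comp j M@(m2 a b c d) N@(m2 na nb nc nd) x zero =
    trans (+-congˡ (*-congˡ (op2-at j N x)))
      (solve 8 (λ a b na nb nc nd x0 xj → a :* (na :* x0 :+ nb :* xj) :+ b :* (nc :* x0 :+ nd :* xj)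
         := (a :* na :+ b :* nc) :* x0 :+ (a :* nb :+ b :* nd) :* xj) refl a b na nb nc nd (x zero) (x (suc j)))
  op2-comp j M@(m2 a b c d) N@(m2 na nb nc nd) x (suc i) = begin
    y (suc i) + e j i * ((c * y zero + d * y (suc j)) - y (suc j))
      ≈⟨ +-congˡ (*-congˡ (+-cong (+-congˡ (*-congˡ (op2-at j N x))) (-‿cong (op2-at j N x)))) ⟩
    (x (suc i) + e j i * ((nc * x₀ + nd * xⱼ) - xⱼ)) + e j i * ((c * (na * x₀ + nb * xⱼ) + d * (nc * x₀ + nd * xⱼ)) - (nc * x₀ + nd * xⱼ))
      ≈⟨ solve 10 (λ c d na nb nc nd x0 xj xi E → (xi :+ E :* ((nc :* x0 :+ nd :* xj) :- xj)) :+ E :* ((c :* (na :* x0 :+ nb :* xj) :+ d :* (nc :* x0 :+ nd :* xj)) :- (nc :* x0 :+ nd :* xj))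
            := xi :+ E :* (((c :* na :+ d :* nc) :* x0 :+ (c :* nb :+ d :* nd) :* xj) :- xj)) refl c d na nb nc nd x₀ xⱼ (x (suc i)) (e j i) ⟩
    op2 j (M ·M N) x (suc i) ∎
    where
      y = op2 j N x
      x₀ = x zero
      xⱼ = x (suc j)

  op2-id : ∀ {k} (j : Fin k) M → IsId M → ∀ x → op2 j M x ≈v x
  op2-id j (m2 a b c d) (pa , pb , pc , pd) x zero =
    trans (+-cong (trans (*-congʳ pa) (*-identityˡ _)) (trans (*-congʳ pb) (zeroˡ _))) (+-identityʳ _)
  op2-id j (m2 a b c d) (pa , pb , pc , pd) x (suc i) =
    trans (+-congˡ (*-congˡ (+-congʳ (+-cong (trans (*-congʳ pc) (zeroˡ _)) (trans (*-congʳ pd) (*-identityˡ _))))))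
      (solve 3 (λ X Y E → X :+ E :* ((con (+ 0) :+ Y) :- Y) := X) refl (x (suc i)) (x (suc j)) (e j i))

  op2-lin : ∀ {k} (j : Fin k) M → IsLinear (op2 j M)
  op2-lin j M@(m2 a b c d) = record { l-cong = cg ; l-⊕ = pl ; l-• = sc }
    where
      cg : ∀ {x y} → x ≈v y → op2 j M x ≈v op2 j M y
      cg p zero = +-cong (*-congˡ (p zero)) (*-congˡ (p (suc j)))
      cg p (suc i) = +-cong (p (suc i)) (*-congˡ (+-cong (+-cong (*-congˡ (p zero)) (*-congˡ (p (suc j)))) (-‿cong (p (suc j)))))
      pl : ∀ x y → op2 j M (x ⊕ y) ≈v (op2 j M x ⊕ op2 j M y)
      pl x y zero = solve 6 (λ a b x0 y0 xj yj → a :* (x0 :+ y0) :+ b :* (xj :+ yj) := (a :* x0 :+ b :* xj) :+ (a :* y0 :+ b :* yj))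
                      refl a b (x zero) (y zero) (x (suc j)) (y (suc j))
      pl x y (suc i) = solve 9 (λ c d x0 y0 xj yj xi yi E → (xi :+ yi) :+ E :* ((c :* (x0 :+ y0) :+ d :* (xj :+ yj)) :- (xj :+ yj))
                         := (xi :+ E :* ((c :* x0 :+ d :* xj) :- xj)) :+ (yi :+ E :* ((c :* y0 :+ d :* yj) :- yj)))
                         refl c d (x zero) (y zero) (x (suc j)) (y (suc j)) (x (suc i)) (y (suc i)) (e j i)
      sc : ∀ s x → op2 j M (s • x) ≈v (s • op2 j M x)
      sc s x zero = solve 5 (λ a b s x0 xj → a :* (s :* x0) :+ b :* (s :* xj) := s :* (a :* x0 :+ b :* xj)) refl a b s (x zero) (x (suc j))
      sc s x (suc i) = solve 7 (λ c d s x0 xj xi E → s :* xi :+ E :* ((c :* (s :* x0) :+ d :* (s :* xj)) :- s :* xj)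
                         := s :* (xi :+ E :* ((c :* x0 :+ d :* xj) :- xj))) refl c d s (x zero) (x (suc j)) (x (suc i)) (e j i)

  record Aut (k : ℕ) : Set where
    field
      fw bw fwT bwT : Vecᶠ k → Vecᶠ k
      fw-lin : IsLinear fw
      bw-lin : IsLinear bw
      fwT-lin : IsLinear fwT
      bwT-lin : IsLinear bwT
      bw-fw : ∀ x → bw (fw x) ≈v x
      fw-bw : ∀ x → fw (bw x) ≈v x
      bwT-fwT : ∀ x → bwT (fwT x) ≈v x
      fwT-bwT : ∀ x → fwT (bwT x) ≈v x
      adj-fw : ∀ ψ x → ⟨ ψ , fw x ⟩ ≈ ⟨ fwT ψ , x ⟩
      adj-bw : ∀ ψ x → ⟨ ψ , bw x ⟩ ≈ ⟨ bwT ψ , x ⟩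

  autId : ∀ {k} → Aut k
  autId = record { fw = λ x → x ; bw = λ x → x ; fwT = λ x → x ; bwT = λ x → x
    ; fw-lin = id-lin ; bw-lin = id-lin ; fwT-lin = id-lin ; bwT-lin = id-lin
    ; bw-fw = λ x → ≈v-refl ; fw-bw = λ x → ≈v-refl ; bwT-fwT = λ x → ≈v-refl ; fwT-bwT = λ x → ≈v-refl
    ; adj-fw = λ ψ x → refl ; adj-bw = λ ψ x → refl }

  -- composition: first A, then B
  _⨾_ : ∀ {k} → Aut k → Aut k → Aut k
  A ⨾ B = record
    { fw = λ x → B.fw (A.fw x) ; bw = λ x → A.bw (B.bw x) ; fwT = λ x → A.fwT (B.fwT x) ; bwT = λ x → B.bwT (A.bwT x)
    ; fw-lin = ∘-lin A.fw-lin B.fw-lin ; bw-lin = ∘-lin B.bw-lin A.bw-lin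
    ; fwT-lin = ∘-lin B.fwT-lin A.fwT-lin ; bwT-lin = ∘-lin A.bwT-lin B.bwT-lin
    ; bw-fw = λ x → ≈v-trans (IsLinear.l-cong A.bw-lin (B.bw-fw _)) (A.bw-fw x)
    ; fw-bw = λ x → ≈v-trans (IsLinear.l-cong B.fw-lin (A.fw-bw _)) (B.fw-bw x)
    ; bwT-fwT = λ x → ≈v-trans (IsLinear.l-cong B.bwT-lin (A.bwT-fwT _)) (B.bwT-fwT x)
    ; fwT-bwT = λ x → ≈v-trans (IsLinear.l-cong A.fwT-lin (B.fwT-bwT _)) (A.fwT-bwT x)
    ; adj-fw = λ ψ x → trans (B.adj-fw ψ (A.fw x)) (A.adj-fw (B.fwT ψ) x)
    ; adj-bw = λ ψ x → trans (A.adj-bw ψ (B.bw x)) (B.adj-bw (A.bwT ψ) x) }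
    where module A = Aut A
          module B = Aut B

  liftV : ∀ {k} → (Vecᶠ k → Vecᶠ k) → Vecᶠ (suc k) → Vecᶠ (suc k)
  liftV f x = x zero ∷ f (tail x)

  lift-lin : ∀ {k} {f : Vecᶠ k → Vecᶠ k} → IsLinear f → IsLinear (liftV f)
  lift-lin {f = f} L = record { l-cong = cg ; l-⊕ = pl ; l-• = sc }
    where
      open IsLinear L
      cg : ∀ {x y} → x ≈v y → liftV f x ≈v liftV f y
      cg p zero = p zero
      cg p (suc i) = l-cong (λ t → p (suc t)) i
      pl : ∀ x y → liftV f (x ⊕ y) ≈v (liftV f x ⊕ liftV f y)
      pl x y zero = refl
      pl x y (suc i) = l-⊕ (tail x) (tail y) i
      sc : ∀ a x → liftV f (a • x) ≈v (a • liftV f x)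
      sc a x zero = refl
      sc a x (suc i) = l-• a (tail x) i

  lift-inv : ∀ {k} {f g : Vecᶠ k → Vecᶠ k} → (∀ x → g (f x) ≈v x) → ∀ x → liftV g (liftV f x) ≈v x
  lift-inv p x zero = refl
  lift-inv p x (suc i) = p (tail x) i

  lift-adj : ∀ {k} {f g : Vecᶠ k → Vecᶠ k} → (∀ ψ x → ⟨ ψ , f x ⟩ ≈ ⟨ g ψ , x ⟩) → ∀ ψ x → ⟨ ψ , liftV f x ⟩ ≈ ⟨ liftV g ψ , x ⟩
  lift-adj p ψ x = +-congˡ (p (tail ψ) (tail x))

  liftAut : ∀ {k} → Aut k → Aut (suc k)
  liftAut A = record
    { fw = liftV A.fw ; bw = liftV A.bw ; fwT = liftV A.fwT ; bwT = liftV A.bwT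
    ; fw-lin = lift-lin A.fw-lin ; bw-lin = lift-lin A.bw-lin ; fwT-lin = lift-lin A.fwT-lin ; bwT-lin = lift-lin A.bwT-lin
    ; bw-fw = lift-inv {f = A.fw} {A.bw} A.bw-fw ; fw-bw = lift-inv {f = A.bw} {A.fw} A.fw-bw
    ; bwT-fwT = lift-inv {f = A.fwT} {A.bwT} A.bwT-fwT ; fwT-bwT = lift-inv {f = A.bwT} {A.fwT} A.fwT-bwT
    ; adj-fw = lift-adj {f = A.fw} {A.fwT} A.adj-fw ; adj-bw = lift-adj {f = A.bw} {A.bwT} A.adj-bw }
    where module A = Aut A

  elemAut : ∀ {k} (j : Fin k) (M M' : M2) → IsId (M ·M M') → IsId (M' ·M M) → Aut (suc k)
  elemAut j M M' p q = record
    { fw = op2 j M ; bw = op2 j M' ; fwT = op2 j (TrM M) ; bwT = op2 j (TrM M')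
    ; fw-lin = op2-lin j M ; bw-lin = op2-lin j M' ; fwT-lin = op2-lin j (TrM M) ; bwT-lin = op2-lin j (TrM M')
    ; bw-fw = λ x → ≈v-trans (op2-comp j M' M x) (op2-id j _ q x)
    ; fw-bw = λ x → ≈v-trans (op2-comp j M M' x) (op2-id j _ p x)
    ; bwT-fwT = λ x → ≈v-trans (op2-comp j (TrM M') (TrM M) x) (op2-id j _ (TrM-· M M' p) x)
    ; fwT-bwT = λ x → ≈v-trans (op2-comp j (TrM M) (TrM M') x) (op2-id j _ (TrM-· M' M q) x)
    ; adj-fw = op2-adj j M ; adj-bw = op2-adj j M' }


-- A size function with a Euclidean division step drives the
-- diagonalisation of submodules of F^k; and for every c ∈ F the cyclic
-- module F/cF and the annihilator Ann(c) = {y | c y ≈ 0} are each a linear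
-- image of the other, which makes F^k/V and its dual have equal rank.
module RingHypotheses (F : CommutativeRing 0ℓ 0ℓ) where

  open import Data.Nat using (ℕ; _<_)
  open import Data.Product using (∃; _×_)
  open import Relation.Binary.PropositionalEquality using (_≡_)

  open CommutativeRing F

  -- One division step on a pair (d , w): either d divides w, or an invertible
  -- change of basis with matrix (u v ; -y x), u x + v y ≈ 1, replaces d by the
  -- common divisor g = u d + v w (so d ≈ x g and w ≈ y g) of smaller size.
  data Step (size : Carrier → ℕ) (d w : Carrier) : Set where
    divides : (q : Carrier) → w ≈ q * d → Step size d w
    reduce : (u v x y : Carrier) → u * x + v * y ≈ 1# →
             d ≈ x * (u * d + v * w) → w ≈ y * (u * d + v * w) →
             size (u * d + v * w) < size d → Step size d w

  record EuclideanSize : Set where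
    field
      size : Carrier → ℕ
      size-cong : ∀ {a b} → a ≈ b → size a ≡ size b
      step : ∀ d w → Step size d w

  record AnnData (c : Carrier) : Set where
    field
      α β : Carrier → Carrier
      α-cong : ∀ {x y} → x ≈ y → α x ≈ α y
      α-+ : ∀ x y → α (x + y) ≈ α x + α y
      α-* : ∀ a x → α (a * x) ≈ a * α x
      α-kill : ∀ q → α (q * c) ≈ 0#
      α-into : ∀ x → c * α x ≈ 0#
      α-onto : ∀ y → c * y ≈ 0# → ∃ λ x → α x ≈ y
      β-cong : ∀ {y y'} → c * y ≈ 0# → c * y' ≈ 0# → y ≈ y' → ∃ λ q → β y - β y' ≈ q * c
      β-+ : ∀ {y y'} → c * y ≈ 0# → c * y' ≈ 0# → ∃ λ q → β (y + y') - (β y + β y') ≈ q * c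
      β-* : ∀ a {y} → c * y ≈ 0# → ∃ λ q → β (a * y) - a * β y ≈ q * c
      β-onto : ∀ x → ∃ λ y → (c * y ≈ 0#) × (∃ λ q → β y - x ≈ q * c)


-- Two kinds of moves are used: invertible
-- recombinations of two generators (which keep the span) and elementary
-- automorphisms of F^k (which move it); the size of the pivot decreases
-- whenever the pivot is replaced, so the procedure terminates.
module Diagonalisation (F : CommutativeRing 0ℓ 0ℓ) where

  open import Data.Nat as ℕ using (ℕ; zero; suc; _<_; _≤_)
  import Data.Nat.Properties as ℕP
  open import Data.Fin using (Fin; zero; suc; toℕ; fromℕ<)
  import Data.Fin.Properties as FP
  open import Data.Integer using (+_)
  open import Data.Product using (Σ; ∃; _×_; _,_)
  open import Data.Sum using (_⊎_; inj₁; inj₂)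
  open import Function.Bundles using (_⇔_; mk⇔; module Equivalence)
  open import Function.Properties.Equivalence using () renaming (refl to ⇔-refl; trans to ⇔-trans)
  open import Relation.Nullary using (yes; no)
  open import Relation.Binary.PropositionalEquality as P using (_≡_)
  open Vectors F
  open Automorphisms F
  open RingHypotheses F
  open Sol using (solve; _:+_; _:*_; _:-_; :-_; _:=_; con)
  open Equivalence using (to; from)
  open import Algebra.Properties.Ring ring using (-‿distribˡ-*)

  SpEq : ∀ {N N' k} → (Fin N → Vecᶠ k) → (Fin N' → Vecᶠ k) → Set
  SpEq g g' = ∀ z → SpanF g z ⇔ SpanF g' z

  spEq-trans : ∀ {N N' N'' k} {g : Fin N → Vecᶠ k} {g' : Fin N' → Vecᶠ k} {g'' : Fin N'' → Vecᶠ k} → SpEq g g' → SpEq g' g'' → SpEq g g''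
  spEq-trans p q z = ⇔-trans (p z) (q z)

  spEq-refl : ∀ {N k} (g : Fin N → Vecᶠ k) → SpEq g g
  spEq-refl g z = ⇔-refl

  spEq-sub : ∀ {N N' k} (g : Fin N → Vecᶠ k) (g' : Fin N' → Vecᶠ k) → (∀ t → SpanF g' (g t)) → (∀ t → SpanF g (g' t)) → SpEq g g'
  spEq-sub g g' p q z = mk⇔ (span-sub g g' p) (span-sub g' g q)

  fam-cong : ∀ {N k} {g g' : Fin N → Vecᶠ k} → (∀ t → g t ≈v g' t) → SpEq g g'
  fam-cong {g = g} {g'} p = spEq-sub g g' (λ t → span-resp g' (≈v-sym (p t)) (span-gen g' t)) (λ t → span-resp g (p t) (span-gen g t))

  two-mem : ∀ {N k} (p r : Vecᶠ k) (rest : Fin N → Vecᶠ k) a b → SpanF (p ∷ r ∷ rest) ((a • p) ⊕ (b • r))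
  two-mem p r rest a b = span-⊕ G (span-• G a (span-gen G zero)) (span-• G b (span-gen G (suc zero)))
    where G = p ∷ r ∷ rest

  two-change : ∀ {N k} (p r p' r' : Vecᶠ k) (rest : Fin N → Vecᶠ k) (a b c d a' b' c' d' : Carrier) →
    p' ≈v ((a • p) ⊕ (b • r)) → r' ≈v ((c • p) ⊕ (d • r)) →
    p ≈v ((a' • p') ⊕ (b' • r')) → r ≈v ((c' • p') ⊕ (d' • r')) →
    SpEq (p ∷ r ∷ rest) (p' ∷ r' ∷ rest)
  two-change {N} {k} p r p' r' rest a b c d a' b' c' d' e1 e2 e3 e4 =
    spEq-sub (p ∷ r ∷ rest) (p' ∷ r' ∷ rest) f1 f2
    where
      f1 : ∀ t → SpanF (p' ∷ r' ∷ rest) ((p ∷ r ∷ rest) t)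
      f1 zero = span-resp (p' ∷ r' ∷ rest) (≈v-sym e3) (two-mem p' r' rest a' b')
      f1 (suc zero) = span-resp (p' ∷ r' ∷ rest) (≈v-sym e4) (two-mem p' r' rest c' d')
      f1 (suc (suc t)) = span-gen (p' ∷ r' ∷ rest) (suc (suc t))
      f2 : ∀ t → SpanF (p ∷ r ∷ rest) ((p' ∷ r' ∷ rest) t)
      f2 zero = span-resp (p ∷ r ∷ rest) (≈v-sym e1) (two-mem p r rest a b)
      f2 (suc zero) = span-resp (p ∷ r ∷ rest) (≈v-sym e2) (two-mem p r rest c d)
      f2 (suc (suc t)) = span-gen (p ∷ r ∷ rest) (suc (suc t))

  insert-mid : ∀ {N N' k} (a b c : Vecᶠ k) (A : Fin N → Vecᶠ k) (B : Fin N' → Vecᶠ k) →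
    SpEq (a ∷ A) (b ∷ B) → SpEq (a ∷ c ∷ A) (b ∷ c ∷ B)
  insert-mid a b c A B eq = spEq-sub (a ∷ c ∷ A) (b ∷ c ∷ B) f1 f2
    where
      emb : ∀ {M} (x : Vecᶠ _) (X : Fin M → Vecᶠ _) → ∀ {z} → SpanF (x ∷ X) z → SpanF (x ∷ c ∷ X) z
      emb x X = span-sub (x ∷ X) (x ∷ c ∷ X) (λ { zero → span-gen (x ∷ c ∷ X) zero ; (suc t) → span-gen (x ∷ c ∷ X) (suc (suc t)) })
      f1 : ∀ t → SpanF (b ∷ c ∷ B) ((a ∷ c ∷ A) t)
      f1 zero = emb b B (to (eq a) (span-gen (a ∷ A) zero))
      f1 (suc zero) = span-gen (b ∷ c ∷ B) (suc zero)
      f1 (suc (suc t)) = emb b B (to (eq (A t)) (span-gen (a ∷ A) (suc t)))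
      f2 : ∀ t → SpanF (a ∷ c ∷ A) ((b ∷ c ∷ B) t)
      f2 zero = emb a A (from (eq b) (span-gen (b ∷ B) zero))
      f2 (suc zero) = span-gen (a ∷ c ∷ A) (suc zero)
      f2 (suc (suc t)) = emb a A (from (eq (B t)) (span-gen (b ∷ B) (suc t)))

  aut-fam : ∀ {N k} (A : Aut k) (G : Fin N → Vecᶠ k) → ∀ y → SpanF G y ⇔ SpanF (λ t → Aut.fw A (G t)) (Aut.fw A y)
  aut-fam A G y = mk⇔ (span-map fw-lin G) back
    where
      open Aut A
      back : SpanF (λ t → fw (G t)) (fw y) → SpanF G y
      back s = to (fam-cong {g = λ t → bw (fw (G t))} {g' = G} (λ t → bw-fw (G t)) y)
                 (span-resp (λ t → bw (fw (G t))) (bw-fw y) (span-map bw-lin (λ t → fw (G t)) s))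

  split-span : ∀ {N k} (p : Vecᶠ (suc k)) (rest : Fin N → Vecᶠ (suc k)) →
    (∀ j → p (suc j) ≈ 0#) → (∀ t → rest t zero ≈ 0#) →
    ∀ z → SpanF (p ∷ rest) z ⇔ ((∃ λ q → z zero ≈ q * p zero) × SpanF (λ t → tail (rest t)) (tail z))
  split-span p rest p-row rest-col z = mk⇔ fwd bwd
    where
      coord₀ : ∀ λs → ΣV (λ t → λs t • (p ∷ rest) t) zero ≈ λs zero * p zero
      coord₀ λs = trans (ΣV-app (λ t → λs t • (p ∷ rest) t) zero)
        (trans (+-congˡ (ΣF-0 (λ t → λs (suc t) * rest t zero) (λ t → trans (*-congˡ (rest-col t)) (zeroʳ _)))) (+-identityʳ _))
      coordₛ : ∀ λs i → ΣV (λ t → λs t • (p ∷ rest) t) (suc i) ≈ ΣV (λ t → λs (suc t) • tail (rest t)) i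
      coordₛ λs i = trans (ΣV-app (λ t → λs t • (p ∷ rest) t) (suc i))
        (trans (trans (+-congʳ (trans (*-congˡ (p-row i)) (zeroʳ _))) (+-identityˡ _))
               (sym (ΣV-app (λ t → λs (suc t) • tail (rest t)) i)))
      fwd : SpanF (p ∷ rest) z → (∃ λ q → z zero ≈ q * p zero) × SpanF (λ t → tail (rest t)) (tail z)
      fwd (λs , ez) = (λs zero , trans (ez zero) (coord₀ λs)) , (tail λs , λ i → trans (ez (suc i)) (coordₛ λs i))
      bwd : (∃ λ q → z zero ≈ q * p zero) × SpanF (λ t → tail (rest t)) (tail z) → SpanF (p ∷ rest) z
      bwd ((q , e₀) , (μ , eₛ)) = (q ∷ μ) , λ
        { zero → trans e₀ (sym (coord₀ (q ∷ μ)))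
        ; (suc i) → trans (eₛ i) (sym (coordₛ (q ∷ μ) i)) }

  shear : Carrier → M2
  shear q = m2 1# 0# (- q) 1#

  shear-inverseˡ : ∀ q → IsId (shear q ·M shear (- q))
  shear-inverseˡ q =
    solve 1 (λ q → con (+ 1) :* con (+ 1) :+ con (+ 0) :* (:- (:- q)) := con (+ 1)) refl q ,
    solve 0 (con (+ 1) :* con (+ 0) :+ con (+ 0) :* con (+ 1) := con (+ 0)) refl ,
    solve 1 (λ q → (:- q) :* con (+ 1) :+ con (+ 1) :* (:- (:- q)) := con (+ 0)) refl q ,
    solve 1 (λ q → (:- q) :* con (+ 0) :+ con (+ 1) :* con (+ 1) := con (+ 1)) refl q

  shear-inverseʳ : ∀ q → IsId (shear (- q) ·M shear q)
  shear-inverseʳ q =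
    solve 1 (λ q → con (+ 1) :* con (+ 1) :+ con (+ 0) :* (:- q) := con (+ 1)) refl q ,
    solve 0 (con (+ 1) :* con (+ 0) :+ con (+ 0) :* con (+ 1) := con (+ 0)) refl ,
    solve 1 (λ q → (:- (:- q)) :* con (+ 1) :+ con (+ 1) :* (:- q) := con (+ 0)) refl q ,
    solve 1 (λ q → (:- (:- q)) :* con (+ 0) :+ con (+ 1) :* con (+ 1) := con (+ 1)) refl q

  bezout : (u v x y : Carrier) → M2
  bezout u v x y = m2 u v (- y) x

  bezout-adj : (u v x y : Carrier) → M2
  bezout-adj u v x y = m2 x (- v) y u

  bezout-inverseˡ : ∀ u v x y → u * x + v * y ≈ 1# → IsId (bezout u v x y ·M bezout-adj u v x y)
  bezout-inverseˡ u v x y det = det ,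
    solve 2 (λ u v → u :* (:- v) :+ v :* u := con (+ 0)) refl u v ,
    solve 2 (λ x y → (:- y) :* x :+ x :* y := con (+ 0)) refl x y ,
    trans (solve 4 (λ u v x y → (:- y) :* (:- v) :+ x :* u := u :* x :+ v :* y) refl u v x y) det

  bezout-inverseʳ : ∀ u v x y → u * x + v * y ≈ 1# → IsId (bezout-adj u v x y ·M bezout u v x y)
  bezout-inverseʳ u v x y det =
    trans (solve 4 (λ u v x y → x :* u :+ (:- v) :* (:- y) := u :* x :+ v :* y) refl u v x y) det ,
    solve 2 (λ v x → x :* v :+ (:- v) :* x := con (+ 0)) refl v x ,
    solve 2 (λ u y → y :* u :+ u :* (:- y) := con (+ 0)) refl u y ,
    trans (solve 4 (λ u v x y → y :* v :+ u :* x := u :* x :+ v :* y) refl u v x y) det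

  bezout-kills : ∀ u v x y d w → d ≈ x * (u * d + v * w) → w ≈ y * (u * d + v * w) → (- y) * d + x * w ≈ 0#
  bezout-kills u v x y d w e1 e2 = trans (+-cong (*-congˡ e1) (*-congˡ e2))
    (solve 3 (λ x y g → (:- y) :* (x :* g) :+ x :* (y :* g) := con (+ 0)) refl x y (u * d + v * w))

  bezout-recover₁ : ∀ u v x y a b → u * x + v * y ≈ 1# → a ≈ x * (u * a + v * b) + (- v) * ((- y) * a + x * b)
  bezout-recover₁ u v x y a b det = sym (trans
    (solve 6 (λ u v x y a b → x :* (u :* a :+ v :* b) :+ (:- v) :* ((:- y) :* a :+ x :* b)
        := (u :* x :+ v :* y) :* a) refl u v x y a b)
    (trans (*-congʳ det) (*-identityˡ a)))

  bezout-recover₂ : ∀ u v x y a b → u * x + v * y ≈ 1# → b ≈ y * (u * a + v * b) + u * ((- y) * a + x * b)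
  bezout-recover₂ u v x y a b det = sym (trans
    (solve 6 (λ u v x y a b → y :* (u :* a :+ v :* b) :+ u :* ((:- y) :* a :+ x :* b)
        := (u :* x :+ v :* y) :* b) refl u v x y a b)
    (trans (*-congʳ det) (*-identityˡ b)))

  module Euclidean (E : EuclideanSize) where
    open EuclideanSize E

    pair-step : ∀ {N k} (p r : Vecᶠ (suc k)) (rest : Fin N → Vecᶠ (suc k)) →
      Σ (Vecᶠ (suc k)) λ p' → Σ (Vecᶠ (suc k)) λ r' →
        SpEq (p ∷ r ∷ rest) (p' ∷ r' ∷ rest) × (r' zero ≈ 0#) × (size (p' zero) ≤ size (p zero))
    pair-step p r rest with step (p zero) (r zero)
    ... | divides q eq = p , (r ⊖ (q • p)) ,
          two-change p r p (r ⊖ (q • p)) rest 1# 0# (- q) 1# 1# 0# q 1#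
            (λ i → sym (trans (+-cong (*-identityˡ _) (zeroˡ _)) (+-identityʳ _)))
            (λ i → solve 3 (λ r q p → r :- q :* p := (:- q) :* p :+ con (+ 1) :* r) refl (r i) q (p i))
            (λ i → sym (trans (+-cong (*-identityˡ _) (zeroˡ _)) (+-identityʳ _)))
            (λ i → solve 3 (λ r q p → r := q :* p :+ con (+ 1) :* (r :- q :* p)) refl (r i) q (p i)) ,
          trans (+-congʳ eq) (-‿inverseʳ _) , ℕP.≤-refl
    ... | reduce u v x y det e1 e2 lt = ((u • p) ⊕ (v • r)) , (((- y) • p) ⊕ (x • r)) ,
          two-change p r _ _ rest u v (- y) x x (- v) y u (λ i → refl) (λ i → refl)
            (λ i → bezout-recover₁ u v x y (p i) (r i) det) (λ i → bezout-recover₂ u v x y (p i) (r i) det) ,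
          bezout-kills u v x y (p zero) (r zero) e1 e2 , ℕP.<⇒≤ lt

    clear-column : ∀ {N k} (p : Vecᶠ (suc k)) (rest : Fin N → Vecᶠ (suc k)) →
      Σ (Vecᶠ (suc k)) λ p' → Σ (Fin N → Vecᶠ (suc k)) λ rest' →
        SpEq (p ∷ rest) (p' ∷ rest') × (∀ t → rest' t zero ≈ 0#) × (size (p' zero) ≤ size (p zero))
    clear-column {zero} p rest = p , rest , spEq-refl (p ∷ rest) , (λ ()) , ℕP.≤-refl
    clear-column {suc N} p rest with pair-step p (rest zero) (tail rest)
    ... | p₁ , r₁ , eq₁ , c₁ , s₁ with clear-column p₁ (tail rest)
    ... | p₂ , rest₂ , eq₂ , c₂ , s₂ = p₂ , (r₁ ∷ rest₂) ,
          spEq-trans {g = p ∷ rest} {g' = p ∷ rest zero ∷ tail rest} {g'' = p₂ ∷ r₁ ∷ rest₂}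
            (fam-cong {g = p ∷ rest} {g' = p ∷ rest zero ∷ tail rest} (λ { zero → ≈v-refl ; (suc zero) → ≈v-refl ; (suc (suc t)) → ≈v-refl }))
            (spEq-trans {g = p ∷ rest zero ∷ tail rest} {g' = p₁ ∷ r₁ ∷ tail rest} {g'' = p₂ ∷ r₁ ∷ rest₂} eq₁ (insert-mid p₁ p₂ r₁ (tail rest) rest₂ eq₂)) ,
          (λ { zero → c₁ ; (suc t) → c₂ t }) , ℕP.≤-trans s₂ s₁

    -- The division step on (c₀ , c_{j+1}) gives an
    -- elementary automorphism killing coordinate j+1 of c; either it fixes
    -- coordinate 0 of every vector (a shear), or it makes c₀ smaller.
    record Elimination {k} (j : Fin k) (c : Vecᶠ (suc k)) : Set where
      field
        M M⁻¹ : M2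
        inverseˡ : IsId (M ·M M⁻¹)
        inverseʳ : IsId (M⁻¹ ·M M)
        kills : op2 j M c (suc j) ≈ 0#
        progress : (∀ x → op2 j M x zero ≈ x zero) ⊎ size (op2 j M c zero) < size (c zero)

      aut : Aut (suc k)
      aut = elemAut j M M⁻¹ inverseˡ inverseʳ

    eliminate : ∀ {k} (j : Fin k) (c : Vecᶠ (suc k)) → Elimination j c
    eliminate j c with step (c zero) (c (suc j))
    ... | divides q eq = record
      { M = shear q ; M⁻¹ = shear (- q)
      ; inverseˡ = shear-inverseˡ q
      ; inverseʳ = shear-inverseʳ q
      ; kills = trans (op2-at j (shear q) c)
          (trans (+-congˡ (trans (*-identityˡ _) eq)) (trans (+-congʳ (sym (-‿distribˡ-* q (c zero)))) (-‿inverseˡ _)))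
      ; progress = inj₁ (λ x → trans (+-cong (*-identityˡ _) (zeroˡ _)) (+-identityʳ _)) }
    ... | reduce u v x y det e1 e2 lt = record
      { M = bezout u v x y ; M⁻¹ = bezout-adj u v x y
      ; inverseˡ = bezout-inverseˡ u v x y det ; inverseʳ = bezout-inverseʳ u v x y det
      ; kills = trans (op2-at j (bezout u v x y) c) (bezout-kills u v x y (c zero) (c (suc j)) e1 e2)
      ; progress = inj₂ lt }

    Cleared : ∀ {k} → ℕ → Vecᶠ (suc k) → Set
    Cleared m c = ∀ j → toℕ j < m → c (suc j) ≈ 0#

    cleared-step : ∀ {k m} (m<k : m < k) M c → Cleared m c →
      op2 (fromℕ< m<k) M c (suc (fromℕ< m<k)) ≈ 0# → Cleared (suc m) (op2 (fromℕ< m<k) M c)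
    cleared-step {m = m} m<k M c cl kills j' j'<1+m with toℕ j' ℕP.≟ m
    ... | yes j'≡m = P.subst (λ i → op2 (fromℕ< m<k) M c (suc i) ≈ 0#)
                       (FP.toℕ-injective (P.trans (FP.toℕ-fromℕ< m<k) (P.sym j'≡m))) kills
    ... | no j'≢m = trans (op2-other (fromℕ< m<k) M c (λ j≡j' → j'≢m (P.trans (P.cong toℕ (P.sym j≡j')) (FP.toℕ-fromℕ< m<k))))
                          (cl j' (ℕP.≤∧≢⇒< (ℕP.≤-pred j'<1+m) j'≢m))

    cleared-all : ∀ {k m} → m ℕ.+ 0 ≡ k → ∀ {c : Vecᶠ (suc k)} → Cleared m c → ∀ j → c (suc j) ≈ 0#
    cleared-all {m = m} m+0≡k cl j = cl j (P.subst (toℕ j <_) (P.trans (P.sym m+0≡k) (ℕP.+-identityʳ m)) (FP.toℕ<n j))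

    SplitsAs : ∀ {N k} → (Fin (suc N) → Vecᶠ (suc k)) → Aut (suc k) → Carrier → (Fin N → Vecᶠ k) → Set
    SplitsAs G B d h = ∀ y → SpanF G y ⇔ ((∃ λ q → Aut.fw B y zero ≈ q * d) × SpanF h (tail (Aut.fw B y)))

    RowOutcome : ∀ {N k} → (Fin (suc N) → Vecᶠ (suc k)) → ℕ → Set
    RowOutcome {N} {k} G s =
      (Σ (Aut (suc k)) λ B → Σ Carrier λ d → Σ (Fin N → Vecᶠ k) λ h → SplitsAs G B d h)
      ⊎ (Σ (Aut (suc k)) λ E → Σ (Vecᶠ (suc k)) λ p → Σ (Fin N → Vecᶠ (suc k)) λ rest →
           (∀ y → SpanF G y ⇔ SpanF (p ∷ rest) (Aut.fw E y)) × (size (p zero) < s))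

    move-generators : ∀ {N N₀ k} (G : Fin N₀ → Vecᶠ (suc k)) (p : Vecᶠ (suc k)) (rest : Fin N → Vecᶠ (suc k)) (C E : Aut (suc k)) →
      (∀ y → SpanF G y ⇔ SpanF (p ∷ rest) (Aut.fw C y)) →
      ∀ y → SpanF G y ⇔ SpanF (Aut.fw E p ∷ (λ t → Aut.fw E (rest t))) (Aut.fw (C ⨾ E) y)
    move-generators G p rest C E inv y = ⇔-trans (inv y) (⇔-trans (aut-fam E (p ∷ rest) (Aut.fw C y))
      (fam-cong {g = λ t → Aut.fw E ((p ∷ rest) t)} {g' = Aut.fw E p ∷ (λ t → Aut.fw E (rest t))} (λ { zero → ≈v-refl ; (suc t) → ≈v-refl }) (Aut.fw E (Aut.fw C y))))

    clear-row : ∀ {N k} (G : Fin (suc N) → Vecᶠ (suc k)) (s : ℕ) (m r : ℕ) → m ℕ.+ r ≡ k →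
      (p : Vecᶠ (suc k)) (rest : Fin N → Vecᶠ (suc k)) (C : Aut (suc k)) →
      (∀ y → SpanF G y ⇔ SpanF (p ∷ rest) (Aut.fw C y)) → (∀ t → rest t zero ≈ 0#) →
      Cleared m p → size (p zero) ≡ s → RowOutcome G s
    clear-row G s m zero m+0≡k p rest C inv col row sz =
      inj₁ (C , p zero , (λ t → tail (rest t)) ,
            λ y → ⇔-trans (inv y) (split-span p rest (cleared-all m+0≡k {p} row) col (Aut.fw C y)))
    clear-row {N} {k} G s m (suc r) m+r≡k p rest C inv col row sz = continue (eliminate j p)
      where
        m<k : m < k
        m<k = P.subst (m <_) m+r≡k (ℕP.m<m+n m (ℕ.s≤s ℕ.z≤n))
        j : Fin k
        j = fromℕ< m<k
        continue : Elimination j p → RowOutcome G s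
        continue el = by-progress progress
          where
            open Elimination el
            by-progress : (∀ x → op2 j M x zero ≈ x zero) ⊎ size (op2 j M p zero) < size (p zero) → RowOutcome G s
            by-progress (inj₁ fixes₀) =
              clear-row G s (suc m) r (P.trans (P.sym (ℕP.+-suc m r)) m+r≡k)
                (op2 j M p) (λ t → op2 j M (rest t)) (C ⨾ aut) (move-generators G p rest C aut inv)
                (λ t → trans (fixes₀ (rest t)) (col t)) (cleared-step m<k M p row kills)
                (P.trans (size-cong (fixes₀ p)) sz)
            by-progress (inj₂ smaller) =
              inj₂ (C ⨾ aut , op2 j M p , (λ t → op2 j M (rest t)) ,
                    move-generators G p rest C aut inv , P.subst (size (op2 j M p zero) <_) sz smaller)

    -- Split off the first coordinate of span (p ∷ rest); the fuel bounds the
    -- size of the pivot, which strictly decreases at every restart.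
    split : ∀ {N k} (fuel : ℕ) (p : Vecᶠ (suc k)) (rest : Fin N → Vecᶠ (suc k)) → size (p zero) < fuel →
      Σ (Aut (suc k)) λ B → Σ Carrier λ d → Σ (Fin N → Vecᶠ k) λ h → SplitsAs (p ∷ rest) B d h
    split {N} {k} (suc fuel) p rest size<fuel with clear-column p rest
    ... | p₁ , rest₁ , eq₁ , col , s₁
      with clear-row (p₁ ∷ rest₁) (size (p₁ zero)) 0 k P.refl p₁ rest₁ autId (λ y → ⇔-refl) col (λ j ()) P.refl
    ... | inj₁ (B , d , h , T) = B , d , h , λ y → ⇔-trans (eq₁ y) (T y)
    ... | inj₂ (E , p₂ , rest₂ , inv₂ , s₂<s₁)
      with split fuel p₂ rest₂ (ℕP.<-≤-trans s₂<s₁ (ℕP.≤-trans s₁ (ℕP.≤-pred size<fuel)))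
    ... | B , d , h , T = (E ⨾ B) , d , h , λ y → ⇔-trans (eq₁ y) (⇔-trans (inv₂ y) (T (Aut.fw E y)))

    diagonalise : ∀ k {N} (g : Fin N → Vecᶠ k) → Σ (Aut k) λ A → Σ (Vecᶠ k) λ d →
      ∀ y → SpanF g y ⇔ (∀ i → ∃ λ q → Aut.fw A y i ≈ q * d i)
    diagonalise zero g = autId , (λ ()) , λ y → mk⇔ (λ _ ()) (λ _ → (λ _ → 0#) , (λ ()))
    diagonalise (suc k) {N} g with split (suc (size 0#)) 0v g ℕP.≤-refl
    ... | B , d₀ , h , T with diagonalise k h
    ... | A , d , R = (B ⨾ liftAut A) , (d₀ ∷ d) , λ y → ⇔-trans (add-zero y) (⇔-trans (T y) (combine (Aut.fw B y)))
      where
        -- a zero generator serves as the initial pivot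
        add-zero : SpEq g (0v ∷ g)
        add-zero = spEq-sub g (0v ∷ g) (λ t → span-gen (0v ∷ g) (suc t))
                                       (λ { zero → span-0 g ; (suc t) → span-gen g t })
        combine : ∀ z → ((∃ λ q → z zero ≈ q * d₀) × SpanF h (tail z)) ⇔ (∀ i → ∃ λ q → liftV (Aut.fw A) z i ≈ q * (d₀ ∷ d) i)
        combine z = mk⇔ (λ { (a , s) → λ { zero → a ; (suc i) → to (R (tail z)) s i } })
                        (λ f → f zero , from (R (tail z)) (λ i → f (suc i)))

    reduce-vector : ∀ {k} (c : Vecᶠ (suc k)) → Σ (Aut (suc k)) λ D → ∀ j → Aut.fw D c (suc j) ≈ 0#
    reduce-vector {k} c = go 0 k P.refl autId (λ j ())
      where
        go : (m r : ℕ) → m ℕ.+ r ≡ k → (C : Aut (suc k)) → Cleared m (Aut.fw C c) →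
             Σ (Aut (suc k)) λ D → ∀ j → Aut.fw D c (suc j) ≈ 0#
        go m zero m+0≡k C cl = C , cleared-all m+0≡k {Aut.fw C c} cl
        go m (suc r) m+r≡k C cl =
          go (suc m) r (P.trans (P.sym (ℕP.+-suc m r)) m+r≡k) (C ⨾ aut) (cleared-step m<k M (Aut.fw C c) cl kills)
          where
            m<k : m < k
            m<k = P.subst (m <_) m+r≡k (ℕP.m<m+n m (ℕ.s≤s ℕ.z≤n))
            open Elimination (eliminate (fromℕ< m<k) (Aut.fw C c))


-- Subsets of a quotient of F^k are described by a
-- relation R (equality in the quotient) and a predicate P (membership); a
-- surjective linear map between two such subquotients transports a
-- surjection from F^r, so it can only lower the rank.
module Rank (F : CommutativeRing 0ℓ 0ℓ) where

  open import Level using (Level; _⊔_)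
  open import Data.Nat using (ℕ; _≤_)
  open import Data.Product using (∃; _×_; _,_)
  open Vectors F

  record LinMap {k k' : ℕ} {q1 p1 q2 p2 : Level}
    (R1 : Vecᶠ k → Vecᶠ k → Set q1) (P1 : Vecᶠ k → Set p1)
    (R2 : Vecᶠ k' → Vecᶠ k' → Set q2) (P2 : Vecᶠ k' → Set p2) : Set (q1 ⊔ p1 ⊔ q2 ⊔ p2) where
    field
      h : Vecᶠ k → Vecᶠ k'
      h-cong : ∀ {x y} → P1 x → P1 y → R1 x y → R2 (h x) (h y)
      h-+ : ∀ {x y} → P1 x → P1 y → R2 (h (x ⊕ y)) (h x ⊕ h y)
      h-• : ∀ a {x} → P1 x → R2 (h (a • x)) (a • h x)
      h-into : ∀ {x} → P1 x → P2 (h x)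
      h-onto : ∀ {y} → P2 y → ∃ λ x → P1 x × R2 (h x) y

  compose : ∀ {r k k' q1 p1 q2 p2}
    {R1 : Vecᶠ k → Vecᶠ k → Set q1} {P1 : Vecᶠ k → Set p1}
    {R2 : Vecᶠ k' → Vecᶠ k' → Set q2} {P2 : Vecᶠ k' → Set p2} →
    (∀ {x y z} → R2 x y → R2 y z → R2 x z) →
    (∀ {x y} → P1 x → P1 y → P1 (x ⊕ y)) → (∀ a {x} → P1 x → P1 (a • x)) →
    SurjLin r R1 P1 → LinMap R1 P1 R2 P2 → SurjLin r R2 P2
  compose {R1 = R1} {P1} {R2} {P2} tr p⊕ p• S L = record
    { f = λ x → h (f x)
    ; f-cong = λ p → h-cong (f-into _) (f-into _) (f-cong p)
    ; f-+ = λ x y → tr (h-cong (f-into (x ⊕ y)) (p⊕ (f-into x) (f-into y)) (f-+ x y)) (h-+ (f-into x) (f-into y))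
    ; f-• = λ a x → tr (h-cong (f-into (a • x)) (p• a (f-into x)) (f-• a x)) (h-• a (f-into x))
    ; f-into = λ x → h-into (f-into x)
    ; f-onto = λ y py → let (x , px , hx) = h-onto py
                            (z , fz) = f-onto x px
                        in z , tr (h-cong (f-into z) px fz) hx }
    where
      open SurjLin S
      open LinMap L

  rank-≤ : ∀ {k k' q1 p1 q2 p2}
    {R1 : Vecᶠ k → Vecᶠ k → Set q1} {P1 : Vecᶠ k → Set p1}
    {R2 : Vecᶠ k' → Vecᶠ k' → Set q2} {P2 : Vecᶠ k' → Set p2} →
    (∀ {x y z} → R2 x y → R2 y z → R2 x z) →
    (∀ {x y} → P1 x → P1 y → P1 (x ⊕ y)) → (∀ a {x} → P1 x → P1 (a • x)) →
    LinMap R1 P1 R2 P2 → ∀ {r1 r2} → HasRank R1 P1 r1 → HasRank R2 P2 r2 → r2 ≤ r1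
  rank-≤ tr p⊕ p• L (S1 , _) (_ , min2) = min2 _ (compose tr p⊕ p• S1 L)

  surj-resp : ∀ {r k q p q' p'} {R : Vecᶠ k → Vecᶠ k → Set q} {P : Vecᶠ k → Set p}
    {R' : Vecᶠ k → Vecᶠ k → Set q'} {P' : Vecᶠ k → Set p'} →
    (∀ {x y} → R x y → R' x y) → (∀ {x} → P x → P' x) → (∀ {x} → P' x → P x) →
    SurjLin r R P → SurjLin r R' P'
  surj-resp RR PP PP' S = record
    { f = f ; f-cong = λ p → RR (f-cong p) ; f-+ = λ x y → RR (f-+ x y) ; f-• = λ a x → RR (f-• a x)
    ; f-into = λ x → PP (f-into x) ; f-onto = λ y py → let (x , e) = f-onto y (PP' py) in x , RR e }
    where open SurjLin S

  rank-resp : ∀ {k q p q' p'} {R : Vecᶠ k → Vecᶠ k → Set q} {P : Vecᶠ k → Set p}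
    {R' : Vecᶠ k → Vecᶠ k → Set q'} {P' : Vecᶠ k → Set p'} →
    (∀ {x y} → R x y → R' x y) → (∀ {x y} → R' x y → R x y) → (∀ {x} → P x → P' x) → (∀ {x} → P' x → P x) →
    ∀ {r} → HasRank R P r → HasRank R' P' r
  rank-resp RR RR' PP PP' (S , m) = surj-resp RR PP PP' S , λ r' S' → m r' (surj-resp RR' PP' PP S')


module Quotient (F : CommutativeRing 0ℓ 0ℓ) where

  open import Data.Nat using (ℕ; zero; suc)
  open import Data.Fin using (Fin; zero; suc)
  open import Data.Integer using (+_)
  open import Data.Product using (_,_)
  open import Data.Unit using (⊤)
  open Vectors F
  open Sol using (solve; _:+_; _:*_; _:-_; :-_; _:=_; con)

  All : ∀ {k} → Vecᶠ k → Set
  All _ = ⊤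

  module Modulo {N k : ℕ} (gens : Fin N → Vecᶠ k) where

    V : Vecᶠ k → Set
    V = SpanF gens

    Rq : Vecᶠ k → Vecᶠ k → Set
    Rq x y = V (x ⊖ y)

    Rq-resp : ∀ {x x' y y'} → x ≈v x' → y ≈v y' → Rq x y → Rq x' y'
    Rq-resp p q = span-resp gens (⊖-cong p q)

    Rq-refl : ∀ {x y} → x ≈v y → Rq x y
    Rq-refl p = span-resp gens (λ i → sym (x≈y⇒x-y≈0 (p i))) (span-0 gens)

    Rq-sym : ∀ {x y} → Rq x y → Rq y x
    Rq-sym {x} {y} r = span-resp gens
      (λ i → solve 2 (λ x y → (:- con (+ 1)) :* (x :- y) := y :- x) refl (x i) (y i)) (span-• gens (- 1#) r)

    Rq-trans : ∀ {x y z} → Rq x y → Rq y z → Rq x z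
    Rq-trans {x} {y} {z} r s = span-resp gens
      (λ i → solve 3 (λ x y z → (x :- y) :+ (y :- z) := x :- z) refl (x i) (y i) (z i)) (span-⊕ gens r s)

    Rq-⊕ : ∀ {x x' y y'} → Rq x x' → Rq y y' → Rq (x ⊕ y) (x' ⊕ y')
    Rq-⊕ {x} {x'} {y} {y'} r s = span-resp gens
      (λ i → solve 4 (λ x x' y y' → (x :- x') :+ (y :- y') := (x :+ y) :- (x' :+ y')) refl (x i) (x' i) (y i) (y' i))
      (span-⊕ gens r s)

    dot-span : ∀ (ψ : Vecᶠ k) → (∀ t → ⟨ ψ , gens t ⟩ ≈ 0#) → ∀ {v} → V v → ⟨ ψ , v ⟩ ≈ 0#
    dot-span ψ ψ⊥gens (λs , v≈) = begin
      ⟨ ψ , _ ⟩                                ≈⟨ dot-cong {ψ = ψ} ≈v-refl v≈ ⟩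
      ⟨ ψ , ΣV (λ t → λs t • gens t) ⟩         ≈⟨ dot-ΣVʳ ψ (λ t → λs t • gens t) ⟩
      ΣF (λ t → ⟨ ψ , λs t • gens t ⟩)         ≈⟨ ΣF-0 _ (λ t → trans (dot-•ʳ ψ (λs t) (gens t)) (trans (*-congˡ (ψ⊥gens t)) (zeroʳ _))) ⟩
      0#                                       ∎

    module _ {r p} {P : Vecᶠ k → Set p} (S : SurjLin r Rq P) where
      open SurjLin S

      surj-0 : Rq (f 0v) 0v
      surj-0 = Rq-trans (f-cong {y = 0# • 0v} (λ i → sym (zeroˡ _))) (Rq-trans (f-• 0# 0v) (Rq-refl (λ i → zeroˡ _)))

      surj-ΣV : ∀ {M} (a : Fin M → Carrier) (v : Fin M → Vecᶠ r) →
                Rq (f (ΣV (λ t → a t • v t))) (ΣV (λ t → a t • f (v t)))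
      surj-ΣV {zero} a v = surj-0
      surj-ΣV {suc M} a v = Rq-trans (f-+ _ _) (Rq-⊕ (f-• _ _) (surj-ΣV (tail a) (tail v)))


-- Row reduction
-- gives D with D c = (g , 0 , … , 0), so ⟨ c , x ⟩ ≈ g · (D⁻ᵀ x)₀ and g is
-- a unit; the hyperplane is therefore Dᵀ {0} × F^r.
module Hyperplane (F : CommutativeRing 0ℓ 0ℓ) (E : RingHypotheses.EuclideanSize F) where

  open import Data.Nat using (suc)
  open import Data.Fin using (zero; suc)
  open import Data.Product using (∃; _,_)
  open Vectors F
  open Automorphisms F
  open Diagonalisation F
  open Euclidean E using (reduce-vector)

  record Parametrisation {r} (c : Vecᶠ (suc r)) : Set where
    field
      K : Vecᶠ r → Vecᶠ (suc r)
      K-linear : IsLinear K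
      K-into : ∀ w → ⟨ c , K w ⟩ ≈ 0#
      K-onto : ∀ x → ⟨ c , x ⟩ ≈ 0# → ∃ λ w → K w ≈v x

  zero∷-lin : ∀ {r} → IsLinear {r} {suc r} (0# ∷_)
  zero∷-lin = record
    { l-cong = λ { p zero → refl ; p (suc i) → p i }
    ; l-⊕ = λ { x y zero → sym (+-identityʳ 0#) ; x y (suc i) → refl }
    ; l-• = λ { a x zero → sym (zeroʳ a) ; a x (suc i) → refl } }

  hyperplane : ∀ {r} (c z : Vecᶠ (suc r)) → ⟨ c , z ⟩ ≈ 1# → Parametrisation c
  hyperplane {r} c z cz with reduce-vector c
  ... | D , Dc-tail≈0 = record
    { K = K ; K-linear = ∘-lin zero∷-lin D.fwT-lin ; K-into = K-into ; K-onto = K-onto }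
    where
      module D = Aut D
      g = D.fw c zero

      through-D : ∀ x → ⟨ c , x ⟩ ≈ g * D.bwT x zero
      through-D x = begin
        ⟨ c , x ⟩                      ≈⟨ dot-cong {ψ = c} {x = x} ≈v-refl (≈v-sym (D.fwT-bwT x)) ⟩
        ⟨ c , D.fwT (D.bwT x) ⟩        ≈⟨ dot-comm c (D.fwT (D.bwT x)) ⟩
        ⟨ D.fwT (D.bwT x) , c ⟩        ≈⟨ sym (D.adj-fw (D.bwT x) c) ⟩
        ⟨ D.bwT x , D.fw c ⟩           ≈⟨ dot-comm (D.bwT x) (D.fw c) ⟩
        g * D.bwT x zero + ΣF (λ j → D.fw c (suc j) * D.bwT x (suc j))
          ≈⟨ +-congˡ (ΣF-0 (λ j → D.fw c (suc j) * D.bwT x (suc j)) (λ j → trans (*-congʳ (Dc-tail≈0 j)) (zeroˡ _))) ⟩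
        g * D.bwT x zero + 0#           ≈⟨ +-identityʳ _ ⟩
        g * D.bwT x zero               ∎

      K : Vecᶠ r → Vecᶠ (suc r)
      K w = D.fwT (0# ∷ w)

      K-into : ∀ w → ⟨ c , K w ⟩ ≈ 0#
      K-into w = trans (through-D (K w)) (trans (*-congˡ (D.bwT-fwT (0# ∷ w) zero)) (zeroʳ g))

      K-onto : ∀ x → ⟨ c , x ⟩ ≈ 0# → ∃ λ w → K w ≈v x
      K-onto x cx = tail y , ≈v-trans (IsLinear.l-cong D.fwT-lin y≈) (D.fwT-bwT x)
        where
          y = D.bwT x
          u = D.bwT z zero
          gu≈1 : g * u ≈ 1#
          gu≈1 = trans (sym (through-D z)) cz
          y₀≈0 : y zero ≈ 0#
          y₀≈0 = begin
            y zero              ≈⟨ sym (*-identityˡ _) ⟩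
            1# * y zero         ≈⟨ *-congʳ (sym gu≈1) ⟩
            (g * u) * y zero    ≈⟨ trans (*-congʳ (*-comm g u)) (*-assoc u g _) ⟩
            u * (g * y zero)    ≈⟨ *-congˡ (trans (sym (through-D x)) cx) ⟩
            u * 0#              ≈⟨ zeroʳ _ ⟩
            0#                  ∎
          y≈ : (0# ∷ tail y) ≈v y
          y≈ zero = sym y₀≈0
          y≈ (suc i) = refl


-- Let V be spanned by a finite family and ψ a functional vanishing on V
-- with ⟨ ψ , z ⟩ ≈ 1.  Then F^k/V ≅ F ⊕ ker ψ, and ker ψ has rank exactly
-- one less than F^k/V: "up" extends a surjection onto ker ψ by the
-- coordinate along z, and "down" restricts a surjection F^{1+r} ↠ F^k/V to
-- the hyperplane of F^{1+r} where ψ vanishes, parametrised by F^r.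
module KernelRank (F : CommutativeRing 0ℓ 0ℓ) (E : RingHypotheses.EuclideanSize F) where

  open import Data.Nat using (ℕ; zero; suc; _∸_)
  import Data.Nat.Properties as ℕP
  open import Data.Fin using (Fin; zero; suc)
  open import Data.Product using (∃; _,_; proj₁; proj₂)
  open import Data.Unit using (tt)
  open import Relation.Binary.PropositionalEquality using (_≡_)
  open Vectors F
  open Quotient F
  open Hyperplane F E
  open Sol using (solve; _:+_; _:*_; _:-_; _:=_)

  Kernel : ∀ {k} → Vecᶠ k → Vecᶠ k → Set
  Kernel ψ x = ⟨ ψ , x ⟩ ≈ 0#

  module WithFunctional {N k : ℕ} (gens : Fin N → Vecᶠ k)
           (ψ z : Vecᶠ k) (ψ⊥gens : ∀ t → ⟨ ψ , gens t ⟩ ≈ 0#) (ψz≈1 : ⟨ ψ , z ⟩ ≈ 1#) where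
    open Modulo gens

    ψ-Rq : ∀ {x y} → Rq x y → ⟨ ψ , x ⟩ ≈ ⟨ ψ , y ⟩
    ψ-Rq {x} {y} r = x-y≈0⇒x≈y (trans (sym (dot-⊖ʳ ψ x y)) (dot-span ψ ψ⊥gens r))

    up : ∀ {r} → SurjLin r Rq (Kernel ψ) → SurjLin (suc r) Rq All
    up {r} S = record
      { f = f' ; f-cong = cg ; f-+ = pl ; f-• = sc ; f-into = λ _ → tt ; f-onto = on }
      where
        open SurjLin S
        f' : Vecᶠ (suc r) → Vecᶠ k
        f' w = (w zero • z) ⊕ f (tail w)
        cg : ∀ {x y} → x ≈v y → Rq (f' x) (f' y)
        cg p = Rq-⊕ (Rq-refl (•-cong (p zero) ≈v-refl)) (f-cong (λ i → p (suc i)))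
        pl : ∀ x y → Rq (f' (x ⊕ y)) (f' x ⊕ f' y)
        pl x y = Rq-trans (Rq-⊕ (Rq-refl ≈v-refl) (f-+ (tail x) (tail y)))
          (Rq-refl (λ i → solve 5 (λ a b Z u v → (a :+ b) :* Z :+ (u :+ v) := (a :* Z :+ u) :+ (b :* Z :+ v))
                                  refl (x zero) (y zero) (z i) (f (tail x) i) (f (tail y) i)))
        sc : ∀ a x → Rq (f' (a • x)) (a • f' x)
        sc a x = Rq-trans (Rq-⊕ (Rq-refl ≈v-refl) (f-• a (tail x)))
          (Rq-refl (λ i → solve 4 (λ a b Z u → (a :* b) :* Z :+ a :* u := a :* (b :* Z :+ u))
                                  refl a (x zero) (z i) (f (tail x) i)))
        -- y = ψ(y) z + (y - ψ(y) z), the second summand lying in ker ψ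
        on : ∀ y → All y → ∃ λ x → Rq (f' x) y
        on y _ = (s ∷ proj₁ pre) , Rq-trans (Rq-⊕ (Rq-refl ≈v-refl) (proj₂ pre))
                   (Rq-refl (λ i → solve 2 (λ a b → a :+ (b :- a) := b) refl (s * z i) (y i)))
          where
            s = ⟨ ψ , y ⟩
            in-ker : Kernel ψ (y ⊖ (s • z))
            in-ker = begin
              ⟨ ψ , y ⊖ (s • z) ⟩        ≈⟨ dot-⊖ʳ ψ y (s • z) ⟩
              s - ⟨ ψ , s • z ⟩          ≈⟨ +-congˡ (-‿cong (trans (dot-•ʳ ψ s z) (trans (*-congˡ ψz≈1) (*-identityʳ s)))) ⟩
              s - s                      ≈⟨ -‿inverseʳ s ⟩
              0#                         ∎
            pre = f-onto (y ⊖ (s • z)) in-ker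

    down : ∀ {r} → SurjLin r Rq All → SurjLin (r ∸ 1) Rq (Kernel ψ)
    down {zero} S = record
      { f = λ _ → 0v ; f-cong = λ _ → Rq-refl ≈v-refl ; f-+ = λ _ _ → Rq-refl (λ i → sym (+-identityʳ 0#))
      ; f-• = λ a _ → Rq-refl (λ i → sym (zeroʳ a)) ; f-into = λ _ → dot-0ʳ ψ
      ; f-onto = λ y _ → (λ ()) , Rq-refl (λ i → sym (all≈0 (y i))) }
      where
        -- F^0 maps onto F^k/V, so z ≡ 0 and the ring is trivial
        open SurjLin S
        z≡0 : Rq 0v z
        z≡0 = Rq-trans (Rq-sym (Rq-trans (f-cong {y = 0v} (λ ())) (surj-0 S))) (proj₂ (f-onto z tt))
        1≈0 : 1# ≈ 0#
        1≈0 = trans (sym ψz≈1) (trans (sym (ψ-Rq z≡0)) (dot-0ʳ ψ))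
        all≈0 : ∀ a → a ≈ 0#
        all≈0 a = trans (sym (*-identityʳ a)) (trans (*-congˡ 1≈0) (zeroʳ a))
    down {suc r} S = record
      { f = λ w → f (K w) ; f-cong = λ p → f-cong (l-cong p)
      ; f-+ = λ x y → Rq-trans (f-cong (l-⊕ x y)) (f-+ _ _) ; f-• = λ a x → Rq-trans (f-cong (l-• a x)) (f-• _ _)
      ; f-into = λ w → trans (ψ∘f (K w)) (K-into w)
      ; f-onto = on }
      where
        open SurjLin S
        c : Vecᶠ (suc r)
        c j = ⟨ ψ , f (e j) ⟩
        ψ∘f : ∀ x → ⟨ ψ , f x ⟩ ≈ ⟨ c , x ⟩
        ψ∘f x = begin
          ⟨ ψ , f x ⟩                            ≈⟨ ψ-Rq (f-cong (expand x)) ⟩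
          ⟨ ψ , f (ΣV (λ j → x j • e j)) ⟩       ≈⟨ ψ-Rq (surj-ΣV S x e) ⟩
          ⟨ ψ , ΣV (λ j → x j • f (e j)) ⟩       ≈⟨ dot-ΣVʳ ψ (λ j → x j • f (e j)) ⟩
          ΣF (λ j → ⟨ ψ , x j • f (e j) ⟩)       ≈⟨ ΣF-cong {f = λ j → ⟨ ψ , x j • f (e j) ⟩} (λ j → trans (dot-•ʳ ψ (x j) (f (e j))) (*-comm _ _)) ⟩
          ⟨ c , x ⟩                              ∎
        z' = proj₁ (f-onto z tt)
        cz'≈1 : ⟨ c , z' ⟩ ≈ 1#
        cz'≈1 = trans (sym (ψ∘f z')) (trans (ψ-Rq (proj₂ (f-onto z tt))) ψz≈1)
        open Parametrisation (hyperplane c z' cz'≈1)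
        open IsLinear K-linear
        on : ∀ y → Kernel ψ y → ∃ λ w → Rq (f (K w)) y
        on y y∈ker with f-onto y tt
        ... | x , fx≡y with K-onto x (trans (sym (ψ∘f x)) (trans (ψ-Rq fx≡y) y∈ker))
        ...   | w , Kw≈x = w , Rq-trans (f-cong Kw≈x) fx≡y

    kernel-rank : ∀ {rH rA} → HasRank Rq (Kernel ψ) rH → HasRank Rq All rA → rH ≡ rA ∸ 1
    kernel-rank {rH} {rA} (SH , minH) (SA , minA) =
      ℕP.≤-antisym (minH (rA ∸ 1) (down SA)) (ℕP.∸-monoˡ-≤ 1 (minA (suc rH) (up SH)))


-- Diagonalise
-- V = A⁻¹ (d₁F × … × d_kF); then F^k/V ≅ ⊕ F/d_iF and, since the transposes
-- of A act on functionals, V^⊥ ≅ ⊕ Ann(d_i).  Coordinatewise, the maps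
-- α : F/d_iF → Ann(d_i) and β : Ann(d_i) → F/d_iF of AnnData give linear
-- surjections in both directions, so each rank bounds the other.
module Duality (F : CommutativeRing 0ℓ 0ℓ)
    (E : RingHypotheses.EuclideanSize F)
    (ann : ∀ c → RingHypotheses.AnnData F c) where

  open import Data.Nat using (ℕ)
  import Data.Nat.Properties as ℕP
  open import Data.Fin using (Fin)
  open import Data.Fin.Properties using () renaming (_≟_ to _≟ᶠ_)
  open import Data.Product using (∃; _×_; _,_; proj₁; proj₂)
  open import Data.Unit using (⊤; tt)
  open import Function.Bundles using (module Equivalence)
  open import Relation.Nullary using (Dec; yes; no)
  open import Relation.Binary.PropositionalEquality as P using (_≡_)
  open Vectors F
  open Automorphisms F
  open Diagonalisation F
  open Quotient F
  open Rank F
  open Euclidean E using (diagonalise)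
  open Equivalence using (to; from)
  open Sol using (solve; _:+_; _:*_; _:-_; _:=_)

  module _ {N k : ℕ} (gens : Fin N → Vecᶠ k) where
    open Modulo gens

    Annihilates : Vecᶠ k → Set
    Annihilates ψ = ∀ t → ⟨ ψ , gens t ⟩ ≈ 0#

    Annihilates-⊕ : ∀ {x y} → Annihilates x → Annihilates y → Annihilates (x ⊕ y)
    Annihilates-⊕ {x} {y} px py t = trans (dot-⊕ˡ x y (gens t)) (trans (+-cong (px t) (py t)) (+-identityʳ 0#))

    Annihilates-• : ∀ a {x} → Annihilates x → Annihilates (a • x)
    Annihilates-• a {x} px t = trans (dot-•ˡ a x (gens t)) (trans (*-congˡ (px t)) (zeroʳ a))

    private
      diagonal = diagonalise k gens
      A = proj₁ diagonal
      module A = Aut A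
      d = proj₁ (proj₂ diagonal)
      V⇔ = proj₂ (proj₂ diagonal)
      module α (i : Fin k) = RingHypotheses.AnnData (ann (d i))

    Multiple : Fin k → Carrier → Set
    Multiple i a = ∃ λ q → a ≈ q * d i

    Multiple-resp : ∀ i {a b} → a ≈ b → Multiple i a → Multiple i b
    Multiple-resp i p (q , e) = q , trans (sym p) e

    Multiple-chain : ∀ i {a b c} → Multiple i (a - b) → Multiple i (b - c) → Multiple i (a - c)
    Multiple-chain i {a} {b} {c} (q , e) (q' , e') = (q + q') ,
      trans (solve 3 (λ a b c → a :- c := (a :- b) :+ (b :- c)) refl a b c)
            (trans (+-cong e e') (sym (distribʳ _ _ _)))

    Rq-via-A : ∀ {z z'} → (∀ i → Multiple i (z i - z' i)) → Rq (A.bw z) (A.bw z')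
    Rq-via-A {z} {z'} p = from (V⇔ (A.bw z ⊖ A.bw z')) (λ i → Multiple-resp i
      (sym (trans (lin-⊖ A.fw-lin (A.bw z) (A.bw z') i) (+-cong (A.fw-bw z i) (-‿cong (A.fw-bw z' i))))) (p i))

    αv : Vecᶠ k → Vecᶠ k
    αv z i = α.α i (z i)

    βv : Vecᶠ k → Vecᶠ k
    βv z i = α.β i (z i)

    αv-lin : IsLinear αv
    αv-lin = record { l-cong = λ p i → α.α-cong i (p i) ; l-⊕ = λ x y i → α.α-+ i (x i) (y i) ; l-• = λ a x i → α.α-* i a (x i) }

    α-Multiple : ∀ i {a b} → Multiple i (a - b) → α.α i a ≈ α.α i b
    α-Multiple i {a} {b} (q , e) = begin
      α.α i a                  ≈⟨ α.α-cong i (solve 2 (λ a b → a := (a :- b) :+ b) refl a b) ⟩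
      α.α i ((a - b) + b)      ≈⟨ α.α-+ i _ _ ⟩
      α.α i (a - b) + α.α i b  ≈⟨ +-congʳ (trans (α.α-cong i e) (α.α-kill i q)) ⟩
      0# + α.α i b             ≈⟨ +-identityˡ _ ⟩
      α.α i b                  ∎

    e-swap : ∀ (f : Fin k → Carrier) i j → f i * e i j ≈ e i j * f j
    e-swap f i j = by-cases (i ≟ᶠ j)
      where
        by-cases : Dec (i ≡ j) → f i * e i j ≈ e i j * f j
        by-cases (yes P.refl) = *-comm _ _
        by-cases (no i≢j) = trans (*-congˡ (e-diff i≢j)) (trans (zeroʳ _) (sym (trans (*-congʳ (e-diff i≢j)) (zeroˡ _))))

    annihilated : ∀ ψ → Annihilates ψ → ∀ i → d i * A.bwT ψ i ≈ 0#
    annihilated ψ ψ⊥ i = begin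
      d i * A.bwT ψ i              ≈⟨ sym (trans (dot-•ʳ (A.bwT ψ) (d i) (e i)) (*-congˡ (dot-eʳ (A.bwT ψ) i))) ⟩
      ⟨ A.bwT ψ , d i • e i ⟩      ≈⟨ sym (A.adj-bw ψ (d i • e i)) ⟩
      ⟨ ψ , A.bw (d i • e i) ⟩     ≈⟨ dot-span ψ ψ⊥ A⁻¹dᵢeᵢ∈V ⟩
      0#                           ∎
      where
        A⁻¹dᵢeᵢ∈V : V (A.bw (d i • e i))
        A⁻¹dᵢeᵢ∈V = from (V⇔ (A.bw (d i • e i)))
          (λ j → Multiple-resp j (sym (A.fw-bw (d i • e i) j)) (e i j , e-swap d i j))

    annihilator : ∀ w → (∀ i → d i * w i ≈ 0#) → Annihilates (A.fwT w)
    annihilator w dw≈0 t = begin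
      ⟨ A.fwT w , gens t ⟩     ≈⟨ sym (A.adj-fw w (gens t)) ⟩
      ⟨ w , A.fw (gens t) ⟩    ≈⟨ ΣF-0 (λ i → w i * A.fw (gens t) i) vanish ⟩
      0#                       ∎
      where
        vanish : ∀ i → w i * A.fw (gens t) i ≈ 0#
        vanish i with to (V⇔ (gens t)) (span-gen gens t) i
        ... | q , eq = trans (*-congˡ eq)
          (trans (solve 3 (λ w q d → w :* (q :* d) := q :* (d :* w)) refl (w i) q (d i))
                 (trans (*-congˡ (dw≈0 i)) (zeroʳ q)))

    Φ : LinMap Rq All _≈v_ Annihilates
    Φ = record
      { h = λ x → A.fwT (αv (A.fw x))
      ; h-cong = λ {x} {y} _ _ x≡y → IsLinear.l-cong A.fwT-lin
          (λ i → α-Multiple i (Multiple-resp i (lin-⊖ A.fw-lin x y i) (to (V⇔ (x ⊖ y)) x≡y i)))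
      ; h-+ = λ {x} {y} _ _ → IsLinear.l-⊕ L x y
      ; h-• = λ a {x} _ → IsLinear.l-• L a x
      ; h-into = λ {x} _ → annihilator (αv (A.fw x)) (λ i → α.α-into i _)
      ; h-onto = onto }
      where
        L = ∘-lin (∘-lin A.fw-lin αv-lin) A.fwT-lin
        onto : ∀ {ψ} → Annihilates ψ → ∃ λ x → ⊤ × (A.fwT (αv (A.fw x)) ≈v ψ)
        onto {ψ} ψ⊥ = A.bw x , tt ,
          ≈v-trans (IsLinear.l-cong A.fwT-lin (≈v-trans (IsLinear.l-cong αv-lin (A.fw-bw x)) αx≈)) (A.fwT-bwT ψ)
          where
            x : Vecᶠ k
            x i = proj₁ (α.α-onto i (A.bwT ψ i) (annihilated ψ ψ⊥ i))
            αx≈ : αv x ≈v A.bwT ψ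
            αx≈ i = proj₂ (α.α-onto i (A.bwT ψ i) (annihilated ψ ψ⊥ i))

    Ψ : LinMap _≈v_ Annihilates Rq All
    Ψ = record
      { h = λ ψ → A.bw (βv (A.bwT ψ))
      ; h-cong = λ {x} {y} px py x≈y → Rq-via-A (λ i →
          α.β-cong i (annihilated x px i) (annihilated y py i) (IsLinear.l-cong A.bwT-lin x≈y i))
      ; h-+ = λ {x} {y} px py → Rq-resp ≈v-refl (IsLinear.l-⊕ A.bw-lin (βv (A.bwT x)) (βv (A.bwT y)))
          (Rq-via-A (λ i → Multiple-chain i
            (α.β-cong i (annihilated (x ⊕ y) (Annihilates-⊕ {x} {y} px py) i)
                        (ann-+ i (annihilated x px i) (annihilated y py i)) (IsLinear.l-⊕ A.bwT-lin x y i))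
            (α.β-+ i (annihilated x px i) (annihilated y py i))))
      ; h-• = λ a {x} px → Rq-resp ≈v-refl (IsLinear.l-• A.bw-lin a (βv (A.bwT x)))
          (Rq-via-A (λ i → Multiple-chain i
            (α.β-cong i (annihilated (a • x) (Annihilates-• a {x} px) i)
                        (ann-* i a (annihilated x px i)) (IsLinear.l-• A.bwT-lin a x i))
            (α.β-* i a (annihilated x px i))))
      ; h-into = λ _ → tt
      ; h-onto = onto }
      where
        ann-+ : ∀ i {a b} → d i * a ≈ 0# → d i * b ≈ 0# → d i * (a + b) ≈ 0#
        ann-+ i p q = trans (distribˡ _ _ _) (trans (+-cong p q) (+-identityʳ 0#))
        ann-* : ∀ i c {a} → d i * a ≈ 0# → d i * (c * a) ≈ 0#
        ann-* i c {a} p = trans (solve 3 (λ d c a → d :* (c :* a) := c :* (d :* a)) refl (d i) c a) (trans (*-congˡ p) (zeroʳ c))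
        onto : ∀ {y} → ⊤ → ∃ λ ψ → Annihilates ψ × Rq (A.bw (βv (A.bwT ψ))) y
        onto {y} _ = A.fwT w , annihilator w dw≈0 ,
                     Rq-resp ≈v-refl (A.bw-fw y) (Rq-via-A (λ i → Multiple-chain i (β-round-trip i) (proj₂ (proj₂ (pre i)))))
          where
            pre : ∀ i → ∃ λ w → (d i * w ≈ 0#) × Multiple i (α.β i w - A.fw y i)
            pre i = α.β-onto i (A.fw y i)
            w : Vecᶠ k
            w i = proj₁ (pre i)
            dw≈0 : ∀ i → d i * w i ≈ 0#
            dw≈0 i = proj₁ (proj₂ (pre i))
            β-round-trip : ∀ i → Multiple i (α.β i (A.bwT (A.fwT w) i) - α.β i (w i))
            β-round-trip i = α.β-cong i (trans (*-congˡ (A.bwT-fwT w i)) (dw≈0 i)) (dw≈0 i) (A.bwT-fwT w i)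

    dual-rank : ∀ {rA rHom} → HasRank Rq All rA → HasRank _≈v_ Annihilates rHom → rA ≡ rHom
    dual-rank hA hHom = ℕP.≤-antisym
      (rank-≤ (λ {x} {y} {z} → Rq-trans {x} {y} {z}) (λ {x} {y} → Annihilates-⊕ {x} {y}) (λ a {x} → Annihilates-• a {x}) Ψ hHom hA)
      (rank-≤ ≈v-trans (λ _ _ → tt) (λ _ _ → tt) Φ hA hHom)


module ModuleSums (F : CommutativeRing 0ℓ 0ℓ) {m ℓm} (M : Module F m ℓm) where

  open import Data.Nat using (ℕ; zero; suc)
  open import Data.Fin using (Fin; zero; suc)
  open import Algebra.Bundles using (CommutativeMonoid)
  open Vectors F
  open WithModule M
  open Module M using (Carrierᴹ; _≈ᴹ_; _+ᴹ_; _*ₗ_; 0ᴹ; ≈ᴹ-refl; ≈ᴹ-sym; ≈ᴹ-trans; ≈ᴹ-setoid; +ᴹ-cong; +ᴹ-congˡ;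
    +ᴹ-assoc; +ᴹ-identityˡ; +ᴹ-identityʳ; +ᴹ-commutativeMonoid; *ₗ-congˡ; *ₗ-congʳ; *ₗ-zeroˡ; *ₗ-zeroʳ;
    *ₗ-distribʳ; *ₗ-distribˡ; *ₗ-identityˡ; *ₗ-assoc)
  open import Algebra.Properties.CommutativeSemigroup (CommutativeMonoid.commutativeSemigroup +ᴹ-commutativeMonoid)
    using (interchange)
  import Relation.Binary.Reasoning.Setoid ≈ᴹ-setoid as MR

  ΣM-cong : ∀ {n} {f g : Fin n → Carrierᴹ} → (∀ i → f i ≈ᴹ g i) → ΣM f ≈ᴹ ΣM g
  ΣM-cong {zero} p = ≈ᴹ-refl
  ΣM-cong {suc n} p = +ᴹ-cong (p zero) (ΣM-cong (λ i → p (suc i)))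

  ΣM-+ : ∀ {n} (f g : Fin n → Carrierᴹ) → ΣM (λ i → f i +ᴹ g i) ≈ᴹ ΣM f +ᴹ ΣM g
  ΣM-+ {zero} f g = ≈ᴹ-sym (+ᴹ-identityˡ 0ᴹ)
  ΣM-+ {suc n} f g = ≈ᴹ-trans (+ᴹ-congˡ (ΣM-+ (tail f) (tail g))) (interchange _ _ _ _)

  ΣM-0 : ∀ {n} (f : Fin n → Carrierᴹ) → (∀ i → f i ≈ᴹ 0ᴹ) → ΣM f ≈ᴹ 0ᴹ
  ΣM-0 {zero} f p = ≈ᴹ-refl
  ΣM-0 {suc n} f p = ≈ᴹ-trans (+ᴹ-cong (p zero) (ΣM-0 (tail f) (λ i → p (suc i)))) (+ᴹ-identityˡ 0ᴹ)

  ΣM-* : ∀ {n} c (f : Fin n → Carrierᴹ) → ΣM (λ i → c *ₗ f i) ≈ᴹ c *ₗ ΣM f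
  ΣM-* {zero} c f = ≈ᴹ-sym (*ₗ-zeroʳ c)
  ΣM-* {suc n} c f = ≈ᴹ-trans (+ᴹ-congˡ (ΣM-* c (tail f))) (≈ᴹ-sym (*ₗ-distribˡ c _ _))

  ΣM-δ : ∀ {n} (i : Fin n) (g : Fin n → Carrierᴹ) → ΣM (λ t → e i t *ₗ g t) ≈ᴹ g i
  ΣM-δ {suc n} zero g = ≈ᴹ-trans
    (+ᴹ-cong (≈ᴹ-trans (*ₗ-congʳ (e-same {suc n} zero)) (*ₗ-identityˡ _))
             (ΣM-0 (λ t → e zero (suc t) *ₗ g (suc t)) (λ t → ≈ᴹ-trans (*ₗ-congʳ (e-0s t)) (*ₗ-zeroˡ _))))
    (+ᴹ-identityʳ _)
  ΣM-δ {suc n} (suc i) g = ≈ᴹ-trans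
    (+ᴹ-cong (≈ᴹ-trans (*ₗ-congʳ (e-s0 i)) (*ₗ-zeroˡ _))
             (≈ᴹ-trans (ΣM-cong {f = λ t → e (suc i) (suc t) *ₗ g (suc t)} (λ t → *ₗ-congʳ (e-suc i t))) (ΣM-δ i (tail g))))
    (+ᴹ-identityˡ _)

  cancelM : ∀ {P Q} → P +ᴹ ((- 1#) *ₗ Q) ≈ᴹ 0ᴹ → P ≈ᴹ Q
  cancelM {P} {Q} h = MR.begin
    P                                    MR.≈⟨ ≈ᴹ-sym (+ᴹ-identityʳ P) ⟩
    P +ᴹ 0ᴹ                              MR.≈⟨ +ᴹ-congˡ (≈ᴹ-sym (≈ᴹ-trans (*ₗ-congʳ (-‿inverseˡ 1#)) (*ₗ-zeroˡ Q))) ⟩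
    P +ᴹ ((- 1# + 1#) *ₗ Q)              MR.≈⟨ +ᴹ-congˡ (*ₗ-distribʳ Q (- 1#) 1#) ⟩
    P +ᴹ (((- 1#) *ₗ Q) +ᴹ (1# *ₗ Q))    MR.≈⟨ ≈ᴹ-sym (+ᴹ-assoc _ _ _) ⟩
    (P +ᴹ ((- 1#) *ₗ Q)) +ᴹ (1# *ₗ Q)    MR.≈⟨ +ᴹ-cong h (*ₗ-identityˡ Q) ⟩
    0ᴹ +ᴹ Q                              MR.≈⟨ +ᴹ-identityˡ Q ⟩
    Q                                    MR.∎

  uncancelM : ∀ {P Q} → P ≈ᴹ Q → P +ᴹ ((- 1#) *ₗ Q) ≈ᴹ 0ᴹ
  uncancelM {P} {Q} h = MR.begin
    P +ᴹ ((- 1#) *ₗ Q)             MR.≈⟨ +ᴹ-cong (≈ᴹ-trans h (≈ᴹ-sym (*ₗ-identityˡ Q))) ≈ᴹ-refl ⟩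
    (1# *ₗ Q) +ᴹ ((- 1#) *ₗ Q)     MR.≈⟨ ≈ᴹ-sym (*ₗ-distribʳ Q 1# (- 1#)) ⟩
    (1# + - 1#) *ₗ Q               MR.≈⟨ *ₗ-congʳ (-‿inverseʳ 1#) ⟩
    0# *ₗ Q                        MR.≈⟨ *ₗ-zeroˡ Q ⟩
    0ᴹ                             MR.∎

  module Evaluation {k : ℕ} (a : Fin k → Carrierᴹ) where

    φ : Vecᶠ k → Carrierᴹ
    φ x = ΣM (λ i → x i *ₗ a i)

    φ-cong : ∀ {x y} → x ≈v y → φ x ≈ᴹ φ y
    φ-cong p = ΣM-cong (λ i → *ₗ-congʳ (p i))

    φ-⊕ : ∀ x y → φ (x ⊕ y) ≈ᴹ φ x +ᴹ φ y
    φ-⊕ x y = ≈ᴹ-trans (ΣM-cong {f = λ i → (x i + y i) *ₗ a i} (λ i → *ₗ-distribʳ (a i) (x i) (y i)))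
                       (ΣM-+ (λ i → x i *ₗ a i) (λ i → y i *ₗ a i))

    φ-• : ∀ c x → φ (c • x) ≈ᴹ c *ₗ φ x
    φ-• c x = ≈ᴹ-trans (ΣM-cong {f = λ i → (c * x i) *ₗ a i} (λ i → *ₗ-assoc c (x i) (a i))) (ΣM-* c (λ i → x i *ₗ a i))

    φ-0 : φ 0v ≈ᴹ 0ᴹ
    φ-0 = ΣM-0 (λ i → 0# *ₗ a i) (λ i → *ₗ-zeroˡ (a i))

    φ-⊖ : ∀ x y → φ (x ⊖ y) ≈ᴹ φ x +ᴹ ((- 1#) *ₗ φ y)
    φ-⊖ x y = ≈ᴹ-trans (φ-cong {y = x ⊕ ((- 1#) • y)} (λ i → +-congˡ (sym (-1*x≈-x _))))
                       (≈ᴹ-trans (φ-⊕ x _) (+ᴹ-congˡ (φ-• (- 1#) y)))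

    φ-ΣV : ∀ {N} (f : Fin N → Vecᶠ k) → φ (ΣV f) ≈ᴹ ΣM (λ t → φ (f t))
    φ-ΣV {zero} f = φ-0
    φ-ΣV {suc N} f = ≈ᴹ-trans (φ-⊕ (f zero) (ΣV (tail f))) (+ᴹ-congˡ (φ-ΣV (tail f)))

    φ-sum : ∀ {s} (i : Fin s → Fin k) → φ (ΣV (λ t → e (i t))) ≈ᴹ ΣM (λ t → a (i t))
    φ-sum i = ≈ᴹ-trans (φ-ΣV (λ t → e (i t))) (ΣM-cong (λ t → ΣM-δ (i t) a))

    φ-relVec : ∀ {s} (i j : Fin s → Fin k) →
               φ (relVec i j) ≈ᴹ ΣM (λ t → a (i t)) +ᴹ ((- 1#) *ₗ ΣM (λ t → a (j t)))
    φ-relVec i j = ≈ᴹ-trans (φ-⊖ (ΣV (λ t → e (i t))) (ΣV (λ t → e (j t)))) (+ᴹ-cong (φ-sum i) (*ₗ-congˡ (φ-sum j)))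

    φ-relVec⇒ : ∀ {s} (i j : Fin s → Fin k) → φ (relVec i j) ≈ᴹ 0ᴹ → ΣM (λ t → a (i t)) ≈ᴹ ΣM (λ t → a (j t))
    φ-relVec⇒ i j h = cancelM (≈ᴹ-trans (≈ᴹ-sym (φ-relVec i j)) h)

    φ-relVec⇐ : ∀ {s} (i j : Fin s → Fin k) → ΣM (λ t → a (i t)) ≈ᴹ ΣM (λ t → a (j t)) → φ (relVec i j) ≈ᴹ 0ᴹ
    φ-relVec⇐ i j h = ≈ᴹ-trans (φ-relVec i j) (uncancelM h)


module FiniteEnumeration where

  open import Data.Nat as ℕ using (ℕ; zero; suc)
  open import Data.Fin as Fin using (Fin; zero; suc; combine; remQuot)
  open import Data.Fin.Properties using (remQuot-combine)
  open import Data.Product using (∃; _×_; _,_; proj₁; proj₂)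
  open import Data.Vec.Functional using (_∷_; tail)
  open import Relation.Binary.PropositionalEquality as P using (_≡_)

  record Enumeration {A : Set} (_≋_ : A → A → Set) : Set where
    field
      size : ℕ
      enum : Fin size → A
      covers : ∀ x → ∃ λ l → enum l ≋ x

  _≗_ : ∀ {s k} → (Fin s → Fin k) → (Fin s → Fin k) → Set
  f ≗ g = ∀ t → f t ≡ g t

  maps : (s k : ℕ) → Enumeration (_≗_ {s} {k})
  maps zero k = record { size = 1 ; enum = λ _ () ; covers = λ f → zero , λ () }
  maps (suc s) k = record { size = k ℕ.* size ; enum = enum' ; covers = covers' }
    where
      open Enumeration (maps s k)
      enum' : Fin (k ℕ.* size) → Fin (suc s) → Fin k
      enum' l = proj₁ (remQuot {k} size l) ∷ enum (proj₂ (remQuot {k} size l))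
      covers' : ∀ f → ∃ λ l → enum' l ≗ f
      covers' f = combine {k} (f zero) l , agree
        where
          l = proj₁ (covers (tail f))
          split = remQuot-combine {k} {size} (f zero) l
          agree : enum' (combine {k} (f zero) l) ≗ f
          agree zero = P.cong proj₁ split
          agree (suc t) = P.trans (P.cong (λ z → enum (proj₂ z) t) split) (proj₂ (covers (tail f)) t)

  pairs : (s k : ℕ) → Enumeration {(Fin s → Fin k) × (Fin s → Fin k)} (λ p q → (proj₁ p ≗ proj₁ q) × (proj₂ p ≗ proj₂ q))
  pairs s k = record { size = size ℕ.* size ; enum = enum² ; covers = covers² }
    where
      open Enumeration (maps s k)
      enum² : Fin (size ℕ.* size) → (Fin s → Fin k) × (Fin s → Fin k)
      enum² p = enum (proj₁ (remQuot {size} size p)) , enum (proj₂ (remQuot {size} size p))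
      covers² : ∀ ij → ∃ λ l → (proj₁ (enum² l) ≗ proj₁ ij) × (proj₂ (enum² l) ≗ proj₂ ij)
      covers² (i , j) = combine {size} li lj ,
          (λ t → P.trans (P.cong (λ z → enum (proj₁ z) t) split) (proj₂ (covers i) t)) ,
          (λ t → P.trans (P.cong (λ z → enum (proj₂ z) t) split) (proj₂ (covers j) t))
        where
          li = proj₁ (covers i)
          lj = proj₁ (covers j)
          split = remQuot-combine {size} {size} li lj


-- R_s(A) is generated by finitely
-- many relation vectors; although membership in ker φ cannot be decided,
-- the conclusion is an equation of natural numbers, so we may assume each
-- of the finitely many candidates decided (double-negation elimination for
-- a decidable goal).  With a finite generating family, ⟨A_{r,s}⟩ is F^k/V,
-- H_A is the kernel of the coordinate-sum functional there, and Freiman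
-- s-homomorphisms are exactly V^⊥; KernelRank and Duality finish the proof.
module Main (F : CommutativeRing 0ℓ 0ℓ)
    (E : RingHypotheses.EuclideanSize F)
    (ann : ∀ c → RingHypotheses.AnnData F c) where

  open import Algebra.Module.Bundles using (Module)
  open import Data.Nat as ℕ using (ℕ; zero; suc; _∸_)
  import Data.Nat.Properties as ℕP
  open import Data.Fin using (Fin; zero; suc)
  open import Data.Fin.Properties using (sequence)
  open import Data.Integer using (+_)
  open import Data.Product using (∃; _×_; _,_; proj₁; proj₂)
  open import Data.Unit using (tt)
  open import Data.Empty using (⊥-elim)
  open import Effect.Monad using (RawMonad)
  open import Relation.Nullary using (Dec; yes; no; ¬_)
  open import Relation.Nullary.Negation using (¬¬-Monad)
  open import Relation.Nullary.Decidable using (¬¬-excluded-middle; decidable-stable; _×-dec_)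
  open import Relation.Binary.PropositionalEquality as P using (_≡_)
  open Vectors F
  open Quotient F
  open Rank F
  open KernelRank F E
  open Duality F E ann
  open FiniteEnumeration
  open Sol using (solve; _:+_; _:-_; _:=_)

  ¬¬-decide-all : ∀ {q} {N : ℕ} (Q : Fin N → Set q) → ¬ ¬ (∀ p → Dec (Q p))
  ¬¬-decide-all Q = sequence (RawMonad.rawApplicative ¬¬-Monad) (λ p → ¬¬-excluded-middle)

  relVec-cong : ∀ {s k} {i i' j j' : Fin s → Fin k} → i ≗ i' → j ≗ j' → relVec i j ≈v relVec i' j'
  relVec-cong {i = i} {i'} {j} {j'} i≗i' j≗j' =
    ⊖-cong (ΣV-cong (λ t → P.subst (λ l → e (i t) ≈v e l) (i≗i' t) ≈v-refl))
           (ΣV-cong (λ t → P.subst (λ l → e (j t) ≈v e l) (j≗j' t) ≈v-refl))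

  pair-relVec : ∀ {s k} (ψ : Vecᶠ k) (i j : Fin s → Fin k) →
                ⟨ ψ , relVec i j ⟩ ≈ ΣF (λ t → ψ (i t)) - ΣF (λ t → ψ (j t))
  pair-relVec ψ i j = trans (dot-⊖ʳ ψ (ΣV (λ t → e (i t))) (ΣV (λ t → e (j t)))) (+-cong (sum-e i) (-‿cong (sum-e j)))
    where
      sum-e : ∀ l → ⟨ ψ , ΣV (λ t → e (l t)) ⟩ ≈ ΣF (λ t → ψ (l t))
      sum-e l = trans (dot-ΣVʳ ψ (λ t → e (l t))) (ΣF-cong {f = λ t → ⟨ ψ , e (l t) ⟩} (λ t → dot-eʳ ψ (l t)))

  ones : ∀ {k} → Vecᶠ k
  ones _ = 1#

  ones-relVec : ∀ {s k} (i j : Fin s → Fin k) → ⟨ ones , relVec i j ⟩ ≈ 0#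
  ones-relVec i j = trans (pair-relVec ones i j) (-‿inverseʳ _)

  differences : ∀ {n} → Fin n → Vecᶠ (suc n)
  differences t = e (suc t) ⊖ e zero

  ones-differences : ∀ {n} (t : Fin n) → ⟨ ones , differences t ⟩ ≈ 0#
  ones-differences {n} t = trans (dot-⊖ʳ ones (e (suc t)) (e zero))
    (trans (+-cong (dot-eʳ (ones {suc n}) (suc t)) (-‿cong (dot-eʳ (ones {suc n}) zero))) (-‿inverseʳ 1#))

  sum-zero⇒differences : ∀ {n} (x : Vecᶠ (suc n)) → ⟨ ones , x ⟩ ≈ 0# →
                         x ≈v ΣV (λ t → x (suc t) • differences t)
  sum-zero⇒differences {n} x Σx≈0 zero = begin
    x zero                        ≈⟨ solve 2 (λ a b → a := (a :+ b) :- b) refl (x zero) S ⟩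
    (x zero + S) - S              ≈⟨ +-congʳ (trans (sym (+-cong (*-identityˡ _) (ΣF-cong {f = λ t → 1# * x (suc t)} (λ t → *-identityˡ _)))) Σx≈0) ⟩
    0# - S                        ≈⟨ trans (+-identityˡ _) (sym (ΣF-neg (tail x))) ⟩
    ΣF (λ t → - x (suc t))        ≈⟨ ΣF-cong {f = λ t → - x (suc t)} (λ t → sym (trans (*-congˡ (e₀-coordinate {t})) (trans (*-comm _ _) (-1*x≈-x _)))) ⟩
    ΣF (λ t → x (suc t) * (e (suc t) zero - e {suc n} zero zero))  ≈⟨ sym (ΣV-app (λ t → x (suc t) • differences t) zero) ⟩
    ΣV (λ t → x (suc t) • differences t) zero ∎
    where
      S = ΣF (tail x)
      e₀-coordinate : ∀ {t : Fin n} → e (suc t) zero - e {suc n} zero zero ≈ - 1#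
      e₀-coordinate {t} = trans (+-cong (e-s0 t) (-‿cong (e-same {suc n} zero))) (+-identityˡ _)
  sum-zero⇒differences x Σx≈0 (suc i) = sym (begin
    ΣV (λ t → x (suc t) • differences t) (suc i)                  ≈⟨ ΣV-app (λ t → x (suc t) • differences t) (suc i) ⟩
    ΣF (λ t → x (suc t) * (e (suc t) (suc i) - e zero (suc i)))   ≈⟨ ΣF-cong (λ t → *-congˡ (trans (+-cong (e-suc t i) (trans (-‿cong (e-0s i)) -0#≈0#)) (+-identityʳ _))) ⟩
    ΣF (λ t → x (suc t) * e t i)                                  ≈⟨ δ-sum' i (tail x) ⟩
    x (suc i)                                                     ∎)

  module Presentation {m ℓm} (M : Module F m ℓm) (s : ℕ) {k : ℕ} (a : Fin k → Module.Carrierᴹ M) where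
    open Module M using (_≈ᴹ_; 0ᴹ; ≈ᴹ-trans)
    open WithModule M
    open WithSet s a
    open ModuleSums F M
    open Evaluation a using (φ-cong; φ-0; φ-relVec⇒; φ-relVec⇐)
    open Enumeration (pairs s k)

    candidate : Fin size → Vecᶠ k
    candidate p = relVec (proj₁ (enum p)) (proj₂ (enum p))

    InKer : Fin size → Set ℓm
    InKer p = φ (candidate p) ≈ᴹ 0ᴹ

    module Decided (decide : ∀ p → Dec (InKer p)) where

      gens : Fin size → Vecᶠ k
      gens p with decide p
      ... | yes _ = candidate p
      ... | no _ = 0v

      open Modulo gens public

      gens-in-RA : ∀ p → InRA (gens p)
      gens-in-RA p with decide p
      ... | yes φ≈0 = (proj₁ (enum p) , proj₂ (enum p) , ≈v-refl) , φ≈0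
      ... | no _ = (proj₁ (enum p) , proj₁ (enum p) , λ _ → sym (-‿inverseʳ _)) , φ-0

      RA-is-generator : ∀ {i j} → φ (relVec i j) ≈ᴹ 0ᴹ → ∃ λ p → gens p ≈v relVec i j
      RA-is-generator {i} {j} φ≈0 with covers (i , j)
      ... | p , i≗ , j≗ = p , selected
        where
          candidate≈ : candidate p ≈v relVec i j
          candidate≈ = relVec-cong i≗ j≗
          selected : gens p ≈v relVec i j
          selected with decide p
          ... | yes _ = candidate≈
          ... | no φ≉0 = ⊥-elim (φ≉0 (≈ᴹ-trans (φ-cong candidate≈) φ≈0))

      ~⇒Rq : ∀ {x y} → x ~ y → Rq x y
      ~⇒Rq (_ , λs , g , g∈RA , x-y≈) = span-resp gens (≈v-sym x-y≈) (span-ΣV gens λs g in-span)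
        where
          in-span : ∀ t → V (g t)
          in-span t with g∈RA t
          ... | (i , j , g≈) , φ≈0 with RA-is-generator {i} {j} (≈ᴹ-trans (φ-cong (≈v-sym g≈)) φ≈0)
          ...   | p , gens≈ = span-resp gens (≈v-trans gens≈ (≈v-sym g≈)) (span-gen gens p)

      Rq⇒~ : ∀ {x y} → Rq x y → x ~ y
      Rq⇒~ (λs , x-y≈) = size , λs , gens , gens-in-RA , x-y≈

      Freiman⇒Annihilates : ∀ {ψ} → IsFreimanHom ψ → Annihilates gens ψ
      Freiman⇒Annihilates {ψ} hom p with decide p
      ... | yes φ≈0 = trans (pair-relVec ψ i j) (x≈y⇒x-y≈0 (hom i j (φ-relVec⇒ i j φ≈0)))
        where i = proj₁ (enum p)
              j = proj₂ (enum p)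
      ... | no _ = dot-0ʳ ψ

      Annihilates⇒Freiman : ∀ {ψ} → Annihilates gens ψ → IsFreimanHom ψ
      Annihilates⇒Freiman {ψ} ψ⊥ i j sums≈ with RA-is-generator {i} {j} (φ-relVec⇐ i j sums≈)
      ... | p , gens≈ = x-y≈0⇒x≈y (trans (sym (pair-relVec ψ i j)) (trans (dot-cong {ψ = ψ} ≈v-refl (≈v-sym gens≈)) (ψ⊥ p)))

      ones-gens : ∀ p → ⟨ ones , gens p ⟩ ≈ 0#
      ones-gens p with decide p
      ... | yes _ = ones-relVec (proj₁ (enum p)) (proj₂ (enum p))
      ... | no _ = dot-0ʳ (ones {k})

  rank-identities : ∀ {m ℓm} (M : Module F m ℓm) (s n : ℕ) (a : Fin (suc n) → Module.Carrierᴹ M) →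
    let open WithModule.WithSetSuc M s a in
    (rH rA rHom : ℕ) → HasRank _~_ InH rH → HasRank _~_ InAgen rA → HasRank _≈v_ IsFreimanHom rHom →
    (rH ≡ rHom ∸ 1) × (rH ≡ rA ∸ 1)
  rank-identities M s n a rH rA rHom hH hA hHom =
    decidable-stable ((rH ℕP.≟ rHom ∸ 1) ×-dec (rH ℕP.≟ rA ∸ 1))
                     (λ ¬goal → ¬¬-decide-all InKer (λ decide → ¬goal (decided decide)))
    where
      open WithModule.WithSetSuc M s a
      open Presentation M s a

      decided : (∀ p → Dec (InKer p)) → (rH ≡ rHom ∸ 1) × (rH ≡ rA ∸ 1)
      decided decide = P.trans rH≡rA∸1 (P.cong (_∸ 1) rA≡rHom) , rH≡rA∸1
        where
          open Decided decide
          open WithFunctional gens ones (e zero) ones-gens (dot-eʳ ones (zero {n}))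

          InH⇒ker : ∀ {x} → InH x → Kernel ones x
          InH⇒ker {x} (λs , x~) = trans (ψ-Rq (~⇒Rq x~))
            (trans (dot-ΣVʳ ones (λ t → λs t • differences t))
                   (ΣF-0 _ (λ t → trans (dot-•ʳ ones (λs t) (differences t)) (trans (*-congˡ (ones-differences t)) (zeroʳ _)))))

          ker⇒InH : ∀ {x} → Kernel ones x → InH x
          ker⇒InH {x} Σx≈0 = tail x , Rq⇒~ (Rq-refl (sum-zero⇒differences x Σx≈0))

          rH≡rA∸1 : rH ≡ rA ∸ 1
          rH≡rA∸1 = kernel-rank
            (rank-resp ~⇒Rq Rq⇒~ InH⇒ker ker⇒InH hH)
            (rank-resp ~⇒Rq Rq⇒~ (λ _ → tt) (λ {x} _ → x , Rq⇒~ (Rq-refl (expand x))) hA)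

          rA≡rHom : rA ≡ rHom
          rA≡rHom = dual-rank gens
            (rank-resp ~⇒Rq Rq⇒~ (λ _ → tt) (λ {x} _ → x , Rq⇒~ (Rq-refl (expand x))) hA)
            (rank-resp (λ p → p) (λ p → p) (λ {ψ} → Freiman⇒Annihilates {ψ}) (λ {ψ} → Annihilates⇒Freiman {ψ}) hHom)


-- ℚ is admissible: it is a field, so a division step either divides by a
-- nonzero pivot or swaps a zero pivot with a nonzero entry (size 1 for 0,
-- size 0 otherwise); and F/cF and Ann(c) are both F (c = 0) or both 0.
module Rationals where

  open import Data.Nat as ℕ using (ℕ)
  import Data.Rational as ℚ
  import Data.Rational.Properties as ℚP
  open import Data.Product using (Σ; _,_)
  open import Relation.Nullary using (yes; no)
  open import Relation.Binary.PropositionalEquality as P using (_≡_; _≢_)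
  open import Data.Empty using (⊥-elim)
  open import Defs using (Ring; ℚ)
  open RingHypotheses (Ring ℚ)
  open import Algebra.Bundles using (CommutativeRing)
  open CommutativeRing (Ring ℚ)
  open import Relation.Binary.Reasoning.Setoid setoid

  size : ℚ.ℚ → ℕ
  size a with a ℚP.≟ ℚ.0ℚ
  ... | yes _ = 1
  ... | no _ = 0

  size-zero : ∀ {a} → a ≡ ℚ.0ℚ → size a ≡ 1
  size-zero {a} a≡0 with a ℚP.≟ ℚ.0ℚ
  ... | yes _ = P.refl
  ... | no a≢0 = ⊥-elim (a≢0 a≡0)

  size-nonzero : ∀ {a} → a ≢ ℚ.0ℚ → size a ≡ 0
  size-nonzero {a} a≢0 with a ℚP.≟ ℚ.0ℚ
  ... | yes a≡0 = ⊥-elim (a≢0 a≡0)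
  ... | no _ = P.refl

  inverse : ∀ (c : ℚ.ℚ) → c ≢ ℚ.0ℚ → Σ ℚ.ℚ λ i → i * c ≈ 1#
  inverse c c≢0 = ℚ.1/_ c {{ℚ.≢-nonZero c≢0}} , ℚP.*-inverseˡ c {{ℚ.≢-nonZero c≢0}}

  cancel : ∀ {c y} → c ≢ ℚ.0ℚ → c * y ≈ 0# → y ≈ 0#
  cancel {c} {y} c≢0 cy≈0 with inverse c c≢0
  ... | i , ic≈1 = begin
    y             ≈⟨ sym (*-identityˡ y) ⟩
    1# * y        ≈⟨ P.cong (_* y) (sym ic≈1) ⟩
    (i * c) * y   ≈⟨ *-assoc i c y ⟩
    i * (c * y)   ≈⟨ P.cong (i *_) cy≈0 ⟩
    i * 0#        ≈⟨ zeroʳ i ⟩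
    0#            ∎

  step : ∀ d w → Step size d w
  step d w with d ℚP.≟ ℚ.0ℚ
  ... | no d≢0 with inverse d d≢0
  ...   | i , id≈1 = divides (w * i) (sym (trans (*-assoc w i d) (trans (P.cong (w *_) id≈1) (*-identityʳ w))))
  step d w | yes d≡0 with w ℚP.≟ ℚ.0ℚ
  ... | yes w≡0 = divides 0# (trans w≡0 (sym (zeroˡ d)))
  ... | no w≢0 = reduce 0# 1# 0# 1# det d≈ w≈ smaller
    where
      swapped : 0# * d + 1# * w ≈ w
      swapped = trans (P.cong₂ _+_ (zeroˡ d) (*-identityˡ w)) (+-identityˡ w)
      det : 0# * 0# + 1# * 1# ≈ 1#
      det = trans (P.cong₂ _+_ (zeroˡ 0#) (*-identityˡ 1#)) (+-identityˡ 1#)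
      d≈ : d ≈ 0# * (0# * d + 1# * w)
      d≈ = trans d≡0 (sym (zeroˡ (0# * d + 1# * w)))
      w≈ : w ≈ 1# * (0# * d + 1# * w)
      w≈ = sym (trans (*-identityˡ _) swapped)
      smaller : size (0# * d + 1# * w) ℕ.< size d
      smaller = P.subst₂ ℕ._<_ (P.sym (size-nonzero (λ g≡0 → w≢0 (trans (sym swapped) g≡0)))) (P.sym (size-zero d≡0)) (ℕ.s≤s ℕ.z≤n)

  euclidean : EuclideanSize
  euclidean = record { size = size ; size-cong = P.cong size ; step = step }

  annihilators : ∀ c → AnnData c
  annihilators c with c ℚP.≟ ℚ.0ℚ
  ... | yes c≡0 = record
    { α = λ x → x ; β = λ x → x
    ; α-cong = λ p → p ; α-+ = λ x y → refl ; α-* = λ a x → refl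
    ; α-kill = λ q → trans (P.cong (q *_) c≡0) (zeroʳ q)
    ; α-into = λ x → trans (P.cong (_* x) c≡0) (zeroˡ x)
    ; α-onto = λ y _ → y , refl
    ; β-cong = λ {y} {y'} _ _ p → 0# , trans (trans (P.cong (_- y') p) (-‿inverseʳ y')) (sym (zeroˡ c))
    ; β-+ = λ {y} {y'} _ _ → 0# , trans (-‿inverseʳ (y + y')) (sym (zeroˡ c))
    ; β-* = λ a {y} _ → 0# , trans (-‿inverseʳ (a * y)) (sym (zeroˡ c))
    ; β-onto = λ x → x , trans (P.cong (_* x) c≡0) (zeroˡ x) , 0# , trans (-‿inverseʳ x) (sym (zeroˡ c)) }
  ... | no c≢0 = record
    { α = λ _ → 0# ; β = λ _ → 0#
    ; α-cong = λ _ → refl ; α-+ = λ x y → sym (+-identityʳ 0#) ; α-* = λ a x → sym (zeroʳ a)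
    ; α-kill = λ q → refl
    ; α-into = λ x → zeroʳ c
    ; α-onto = λ y cy≈0 → 0# , sym (cancel c≢0 cy≈0)
    ; β-cong = λ _ _ _ → 0# , trans (-‿inverseʳ 0#) (sym (zeroˡ c))
    ; β-+ = λ _ _ → 0# , trans (P.cong (λ t → 0# - t) (+-identityʳ 0#)) (trans (-‿inverseʳ 0#) (sym (zeroˡ c)))
    ; β-* = λ a _ → 0# , trans (P.cong (λ t → 0# - t) (zeroʳ a)) (trans (-‿inverseʳ 0#) (sym (zeroˡ c)))
    ; β-onto = λ x → 0# , zeroʳ c , β-onto x }
    where
      β-onto : ∀ x → Σ ℚ.ℚ λ q → 0# - x ≈ q * c
      β-onto x with inverse c c≢0
      ... | i , ic≈1 = (- x) * i ,
        trans (+-identityˡ (- x)) (sym (trans (*-assoc (- x) i c) (trans (P.cong ((- x) *_) ic≈1) (*-identityʳ (- x)))))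


-- The size of a is gcd(|a|, m): if gcd(d, m)
-- divides w then w is a multiple of d modulo m (Bézout), and otherwise
-- g = gcd(d, w) = u d + v w with d = x g, w = y g gives u x + v y = 1 and a
-- strictly smaller size.  With g = gcd(c, m) and m = H g, the annihilator of
-- c is H·ℤ/m, and α x = H x, β y = y / H relate it to ℤ/cℤ = ℤ/gℤ.
module IntegersMod where

  open import Data.Nat as ℕ using (ℕ; zero; suc)
  import Data.Nat.Properties as ℕP
  import Data.Nat.Divisibility as ℕD
  import Data.Nat.DivMod as ℕM
  open import Data.Nat.GCD as G using (gcd)
  open import Data.Integer as ℤ using (ℤ; +_; -[1+_]; ∣_∣)
  import Data.Integer.Properties as ℤP
  open import Data.Integer.Divisibility.Signed as ZD using (∣ᵤ⇒∣; ∣⇒∣ᵤ)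
  open import Data.Integer.Tactic.RingSolver using (solve-∀)
  import Data.Sign as Sign
  open import Data.Product using (Σ; ∃; _×_; _,_; proj₁; proj₂)
  open import Data.Sum using (inj₂)
  open import Relation.Nullary using (yes; no; ¬_)
  open import Relation.Binary.PropositionalEquality as P using (_≡_; _≢_; refl; cong; sym; trans)
  open import Data.Empty using (⊥-elim)
  open import Defs using (module ZMod)

  sign-unit : ∀ a → Σ ℤ λ σ → σ ℤ.* a ≡ + ∣ a ∣
  sign-unit (+ n) = + 1 , ℤP.*-identityˡ (+ n)
  sign-unit -[1+ n ] = ℤ.- (+ 1) , cong (λ t → + suc t) (ℕP.+-identityʳ n)

  ℕ-identity : ∀ {g x y A B} → g ℕ.+ y ℕ.* B ≡ x ℕ.* A → + g ≡ + x ℤ.* + A ℤ.- + y ℤ.* + B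
  ℕ-identity {g} {x} {y} {A} {B} eq = trans (add-sub (+ g) (+ y ℤ.* + B)) (cong (ℤ._- (+ y ℤ.* + B)) lifted)
    where
      add-sub : ∀ g c → g ≡ (g ℤ.+ c) ℤ.- c
      add-sub = solve-∀
      lifted : + g ℤ.+ + y ℤ.* + B ≡ + x ℤ.* + A
      lifted = trans (cong (λ t → + g ℤ.+ t) (sym (ℤP.pos-* y B)))
                     (trans (sym (ℤP.pos-+ g (y ℕ.* B))) (trans (cong +_ eq) (ℤP.pos-* x A)))

  signed : ∀ {g A B} x σa a y σb b → σa ℤ.* a ≡ + A → σb ℤ.* b ≡ + B →
           + g ≡ x ℤ.* + A ℤ.- y ℤ.* + B → (x ℤ.* σa) ℤ.* a ℤ.+ (ℤ.- y ℤ.* σb) ℤ.* b ≡ + g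
  signed x σa a y σb b σa·a σb·b g≡ =
    trans (regroup x σa a y σb b) (trans (P.cong₂ (λ p q → x ℤ.* p ℤ.- y ℤ.* q) σa·a σb·b) (sym g≡))
    where
      regroup : ∀ x σa a y σb b → (x ℤ.* σa) ℤ.* a ℤ.+ (ℤ.- y ℤ.* σb) ℤ.* b ≡ x ℤ.* (σa ℤ.* a) ℤ.- y ℤ.* (σb ℤ.* b)
      regroup = solve-∀

  bezout : ∀ a b → Σ ℤ λ s → Σ ℤ λ t → s ℤ.* a ℤ.+ t ℤ.* b ≡ + gcd ∣ a ∣ ∣ b ∣
  bezout a b with G.Bézout.identity (G.gcd-GCD ∣ a ∣ ∣ b ∣) | sign-unit a | sign-unit b
  ... | G.Bézout.+- x y eq | σa , σa·a | σb , σb·b =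
    (+ x ℤ.* σa) , (ℤ.- (+ y) ℤ.* σb) , signed (+ x) σa a (+ y) σb b σa·a σb·b (ℕ-identity {x = x} {y} {∣ a ∣} {∣ b ∣} eq)
  ... | G.Bézout.-+ x y eq | σa , σa·a | σb , σb·b =
    (ℤ.- (+ x) ℤ.* σa) , (+ y ℤ.* σb) ,
    trans (ℤP.+-comm ((ℤ.- (+ x) ℤ.* σa) ℤ.* a) ((+ y ℤ.* σb) ℤ.* b))
          (signed (+ y) σb b (+ x) σa a σb·b σa·a (ℕ-identity {x = y} {x} {∣ b ∣} {∣ a ∣} eq))

  gcd∣ˡ : ∀ a b → + gcd ∣ a ∣ ∣ b ∣ ZD.∣ a
  gcd∣ˡ a b = ∣ᵤ⇒∣ (G.gcd[m,n]∣m ∣ a ∣ ∣ b ∣)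
  gcd∣ʳ : ∀ a b → + gcd ∣ a ∣ ∣ b ∣ ZD.∣ b
  gcd∣ʳ a b = ∣ᵤ⇒∣ (G.gcd[m,n]∣n ∣ a ∣ ∣ b ∣)
  gcd-greatest-ℤ : ∀ {a b} c → + c ZD.∣ a → + c ZD.∣ b → c ℕD.∣ gcd ∣ a ∣ ∣ b ∣
  gcd-greatest-ℤ c p q = G.gcd-greatest (∣⇒∣ᵤ p) (∣⇒∣ᵤ q)

  exact-div : ℤ → ℕ → ℤ
  exact-div z h = ℤ.sign z ℤ.◃ (∣ z ∣ ℕM./ suc h)

  sign-+◃ : ∀ n → ℤ.sign (Sign.+ ℤ.◃ n) ≡ Sign.+
  sign-+◃ zero = refl
  sign-+◃ (suc n) = refl

  exact-div-correct : ∀ h a → exact-div (+ suc h ℤ.* a) h ≡ a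
  exact-div-correct h (+ k) = begin
    ℤ.sign (Sign.+ ℤ.◃ (suc h ℕ.* k)) ℤ.◃ (∣ Sign.+ ℤ.◃ (suc h ℕ.* k) ∣ ℕM./ suc h)
      ≡⟨ P.cong₂ ℤ._◃_ (sign-+◃ (suc h ℕ.* k)) (cong (ℕM._/ suc h) (ℤP.abs-◃ Sign.+ (suc h ℕ.* k))) ⟩
    Sign.+ ℤ.◃ (suc h ℕ.* k ℕM./ suc h) ≡⟨ cong (λ t → Sign.+ ℤ.◃ (t ℕM./ suc h)) (ℕP.*-comm (suc h) k) ⟩
    Sign.+ ℤ.◃ (k ℕ.* suc h ℕM./ suc h) ≡⟨ cong (Sign.+ ℤ.◃_) (ℕM.m*n/n≡m k (suc h)) ⟩
    Sign.+ ℤ.◃ k ≡⟨ ℤP.+◃n≡+n k ⟩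
    + k ∎
    where open P.≡-Reasoning
  exact-div-correct h -[1+ k ] = cong (Sign.- ℤ.◃_) (trans (cong (ℕM._/ suc h) (ℕP.*-comm (suc h) (suc k))) (ℕM.m*n/n≡m (suc k) (suc h)))

  module Modulus (m' : ℕ) where
    m : ℕ
    m = suc m'

    open ZMod m using (_≈_; ≡⇒≈; commutativeRing)
    open RingHypotheses commutativeRing

    mℤ : ℤ
    mℤ = + m

    size : ℤ → ℕ
    size a = gcd ∣ a ∣ m

    size≢0 : ∀ a → gcd ∣ a ∣ m ≢ 0
    size≢0 a = G.gcd[m,n]≢0 ∣ a ∣ m (inj₂ (λ ()))

    size-divides : ∀ a b q → a ℤ.- b ≡ q ℤ.* mℤ → size a ℕD.∣ size b
    size-divides a b q e = gcd-greatest-ℤ (size a) d∣b (gcd∣ʳ a mℤ)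
      where
        be : b ≡ a ℤ.- q ℤ.* mℤ
        be = P.trans (L b a q mℤ) (P.cong (λ t → a ℤ.- t) e)
          where L : ∀ b a q M → b ≡ a ℤ.- (a ℤ.- b)
                L = solve-∀
        d∣b : + size a ZD.∣ b
        d∣b = P.subst (+ size a ZD.∣_) (P.sym be) (ZD.∣m∣n⇒∣m-n (gcd∣ˡ a mℤ) (ZD.∣n⇒∣m*n q (gcd∣ʳ a mℤ)))

    size-cong : ∀ {a b} → a ≈ b → size a ≡ size b
    size-cong {a} {b} (q , e) = ℕD.∣-antisym (size-divides a b q e) (size-divides b a (ℤ.- q) e')
      where e' : b ℤ.- a ≡ ℤ.- q ℤ.* mℤ
            e' = P.trans (L a b) (P.trans (P.cong ℤ.-_ e) (ℤP.neg-distribˡ-* q mℤ))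
              where L : ∀ a b → b ℤ.- a ≡ ℤ.- (a ℤ.- b)
                    L = solve-∀

    -- if gcd(d, m) divides w then w ≡ q d (mod m), by Bézout for d and m
    multiple-mod-m : ∀ d w → size d ℕD.∣ ∣ w ∣ → ∃ λ q → w ≈ q ℤ.* d
    multiple-mod-m d w dv = r ℤ.* s , r ℤ.* t ,
      P.trans (P.cong (λ z → z ℤ.- (r ℤ.* s) ℤ.* d) (P.trans w≡ (P.cong (r ℤ.*_) (P.sym bz)))) (L r s t d mℤ)
      where
        s = proj₁ (bezout d mℤ)
        t = proj₁ (proj₂ (bezout d mℤ))
        bz : s ℤ.* d ℤ.+ t ℤ.* mℤ ≡ + size d
        bz = proj₂ (proj₂ (bezout d mℤ))
        dvs = ∣ᵤ⇒∣ {+ size d} {w} dv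
        r = ZD._∣_.quotient dvs
        w≡ : w ≡ r ℤ.* + size d
        w≡ = ZD._∣_.equality dvs
        L : ∀ r s t d M → r ℤ.* (s ℤ.* d ℤ.+ t ℤ.* M) ℤ.- (r ℤ.* s) ℤ.* d ≡ (r ℤ.* t) ℤ.* M
        L = solve-∀

    module CommonDivisor (d w : ℤ) (ndv : ¬ (size d ℕD.∣ ∣ w ∣)) where
      g : ℕ
      g = gcd ∣ d ∣ ∣ w ∣

      u v x y : ℤ
      u = proj₁ (bezout d w)
      v = proj₁ (proj₂ (bezout d w))
      x = ZD._∣_.quotient (gcd∣ˡ d w)
      y = ZD._∣_.quotient (gcd∣ʳ d w)

      ud+vw≡g : u ℤ.* d ℤ.+ v ℤ.* w ≡ + g
      ud+vw≡g = proj₂ (proj₂ (bezout d w))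

      d≡xg : d ≡ x ℤ.* + g
      d≡xg = ZD._∣_.equality (gcd∣ˡ d w)

      w≡yg : w ≡ y ℤ.* + g
      w≡yg = ZD._∣_.equality (gcd∣ʳ d w)

      -- g ≢ 0, for otherwise w = 0 would be divisible by gcd(d, m)
      g≢0 : g ≢ 0
      g≢0 g≡0 = ndv (P.subst (size d ℕD.∣_) (P.sym ∣w∣≡0) (ℕD._∣0 (size d)))
        where
          ∣w∣≡0 : ∣ w ∣ ≡ 0
          ∣w∣≡0 = P.trans (P.cong ∣_∣ w≡yg) (P.trans (ℤP.abs-* y (+ g)) (P.trans (P.cong (∣ y ∣ ℕ.*_) g≡0) (ℕP.*-zeroʳ ∣ y ∣)))

      instance
        g-nonZero : ℕ.NonZero g
        g-nonZero = ℕ.≢-nonZero g≢0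

      -- (u x + v y) g = u d + v w = g, so u x + v y = 1
      det : u ℤ.* x ℤ.+ v ℤ.* y ≡ + 1
      det = ℤP.*-cancelʳ-≡ (u ℤ.* x ℤ.+ v ℤ.* y) (+ 1) (+ g)
        (P.trans (L u x v y (+ g)) (P.trans (P.cong₂ (λ a b → u ℤ.* a ℤ.+ v ℤ.* b) (P.sym d≡xg) (P.sym w≡yg))
                                            (P.trans ud+vw≡g (P.sym (ℤP.*-identityˡ (+ g))))))
        where L : ∀ u x v y g → (u ℤ.* x ℤ.+ v ℤ.* y) ℤ.* g ≡ u ℤ.* (x ℤ.* g) ℤ.+ v ℤ.* (y ℤ.* g)
              L = solve-∀

      -- gcd(g, m) divides gcd(d, m), and is different from it because gcd(d, m) ∤ w
      smaller : size (u ℤ.* d ℤ.+ v ℤ.* w) ℕ.< size d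
      smaller = P.subst (ℕ._< size d) (P.sym (P.cong (λ z → gcd ∣ z ∣ m) ud+vw≡g)) (ℕP.≤∧≢⇒< (ℕD.∣⇒≤ divides-d) differs)
        where
          instance
            size-nonZero : ℕ.NonZero (size d)
            size-nonZero = ℕ.≢-nonZero (size≢0 d)
          divides-d : gcd g m ℕD.∣ size d
          divides-d = G.gcd-greatest (ℕD.∣-trans (G.gcd[m,n]∣m g m) (G.gcd[m,n]∣m ∣ d ∣ ∣ w ∣)) (G.gcd[m,n]∣n g m)
          differs : gcd g m ≢ size d
          differs eq = ndv (P.subst (ℕD._∣ ∣ w ∣) eq (ℕD.∣-trans (G.gcd[m,n]∣m g m) (G.gcd[m,n]∣n ∣ d ∣ ∣ w ∣)))

    reduce-step : ∀ d w → ¬ (size d ℕD.∣ ∣ w ∣) → Step size d w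
    reduce-step d w ndv = reduce u v x y (≡⇒≈ det)
      (≡⇒≈ (P.trans d≡xg (P.cong (x ℤ.*_) (P.sym ud+vw≡g))))
      (≡⇒≈ (P.trans w≡yg (P.cong (y ℤ.*_) (P.sym ud+vw≡g))))
      smaller
      where open CommonDivisor d w ndv

    step : ∀ d w → Step size d w
    step d w with size d ℕD.∣? ∣ w ∣
    ... | yes dv = divides (proj₁ (multiple-mod-m d w dv)) (proj₂ (multiple-mod-m d w dv))
    ... | no ndv = reduce-step d w ndv

    euclidean : EuclideanSize
    euclidean = record { size = size ; size-cong = λ {a} {b} → size-cong {a} {b} ; step = step }

    module Annihilator (c : ℤ) where
      g : ℕ
      g = size c

      instance
        g≢0 : ℕ.NonZero g
        g≢0 = ℕ.≢-nonZero (size≢0 c)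

      cofactor : Σ ℕ λ h → m ≡ suc h ℕ.* g
      cofactor with G.gcd[m,n]∣n ∣ c ∣ m
      ... | ℕD.divides zero eq = ⊥-elim (ℕP.1+n≢0 eq)
      ... | ℕD.divides (suc h) eq = h , eq

      h : ℕ
      h = proj₁ cofactor

      H : ℤ
      H = + suc h

      m≡Hg : mℤ ≡ H ℤ.* + g
      m≡Hg = P.trans (P.cong +_ (proj₂ cofactor)) (ℤP.pos-* (suc h) g)

      c' : ℤ
      c' = ZD._∣_.quotient (gcd∣ˡ c mℤ)

      c≡c'g : c ≡ c' ℤ.* + g
      c≡c'g = ZD._∣_.equality (gcd∣ˡ c mℤ)

      s t : ℤ
      s = proj₁ (bezout c mℤ)
      t = proj₁ (proj₂ (bezout c mℤ))

      sc+tm≡g : s ℤ.* c ℤ.+ t ℤ.* mℤ ≡ + g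
      sc+tm≡g = proj₂ (proj₂ (bezout c mℤ))

      cH≡c'm : c ℤ.* H ≡ c' ℤ.* mℤ
      cH≡c'm = P.trans (P.cong (ℤ._* H) c≡c'g) (P.trans (L c' (+ g) H) (P.cong (c' ℤ.*_) (P.sym m≡Hg)))
        where L : ∀ c g H → (c ℤ.* g) ℤ.* H ≡ c ℤ.* (H ℤ.* g)
              L = solve-∀

      multiple-of-g : ∀ z r → z ≡ r ℤ.* + g → ∃ λ q → z ≈ q ℤ.* c
      multiple-of-g z r z≡rg = r ℤ.* s , r ℤ.* t ,
        P.trans (P.cong (λ w → w ℤ.- (r ℤ.* s) ℤ.* c) (P.trans z≡rg (P.cong (r ℤ.*_) (P.sym sc+tm≡g)))) (L r s t c mℤ)
        where L : ∀ r s t c M → r ℤ.* (s ℤ.* c ℤ.+ t ℤ.* M) ℤ.- (r ℤ.* s) ℤ.* c ≡ (r ℤ.* t) ℤ.* M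
              L = solve-∀

      zero-multiple : ∀ z → z ≡ + 0 → ∃ λ q → z ≈ q ℤ.* c
      zero-multiple z z≡0 = multiple-of-g z (+ 0) (P.trans z≡0 (P.sym (ℤP.*-zeroˡ (+ g))))

      annihilated⇒H∣ : ∀ {y} → c ℤ.* y ≈ + 0 → Σ ℤ λ a → y ≡ H ℤ.* a
      annihilated⇒H∣ {y} (k , cy-0≡km) = (s ℤ.* k ℤ.+ t ℤ.* y) , P.trans (ℤP.*-cancelʳ-≡ y _ (+ g) yg≡) (ℤP.*-comm _ H)
        where
          cy≡km : c ℤ.* y ≡ k ℤ.* mℤ
          cy≡km = P.trans (L0 (c ℤ.* y)) cy-0≡km
            where L0 : ∀ z → z ≡ z ℤ.- + 0
                  L0 = solve-∀
          -- y g = y (s c + t m) = (s k + t y) m = ((s k + t y) H) g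
          yg≡ : y ℤ.* + g ≡ ((s ℤ.* k ℤ.+ t ℤ.* y) ℤ.* H) ℤ.* + g
          yg≡ = P.trans (P.cong (y ℤ.*_) (P.sym sc+tm≡g)) (P.trans (L1 y s c t mℤ)
                  (P.trans (P.cong (λ z → s ℤ.* z ℤ.+ t ℤ.* mℤ ℤ.* y) cy≡km)
                  (P.trans (L2 s k t y mℤ) (P.trans (P.cong ((s ℤ.* k ℤ.+ t ℤ.* y) ℤ.*_) m≡Hg) (L3 (s ℤ.* k ℤ.+ t ℤ.* y) H (+ g))))))
            where L1 : ∀ y s c t M → y ℤ.* (s ℤ.* c ℤ.+ t ℤ.* M) ≡ s ℤ.* (c ℤ.* y) ℤ.+ t ℤ.* M ℤ.* y
                  L1 = solve-∀
                  L2 : ∀ s k t y M → s ℤ.* (k ℤ.* M) ℤ.+ t ℤ.* M ℤ.* y ≡ (s ℤ.* k ℤ.+ t ℤ.* y) ℤ.* M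
                  L2 = solve-∀
                  L3 : ∀ a H g → a ℤ.* (H ℤ.* g) ≡ (a ℤ.* H) ℤ.* g
                  L3 = solve-∀

      α : ℤ → ℤ
      α x = H ℤ.* x

      β : ℤ → ℤ
      β y = exact-div y h

      β-H : ∀ {y} a → y ≡ H ℤ.* a → β y ≡ a
      β-H a y≡Ha = P.trans (P.cong (λ z → exact-div z h) y≡Ha) (exact-div-correct h a)

      H-comm : ∀ a x → H ℤ.* (a ℤ.* x) ≡ a ℤ.* (H ℤ.* x)
      H-comm a x = P.trans (P.sym (ℤP.*-assoc H a x)) (P.trans (P.cong (ℤ._* x) (ℤP.*-comm H a)) (ℤP.*-assoc a H x))

      α-cong : ∀ {x y} → x ≈ y → α x ≈ α y
      α-cong {x} {y} (q , e) = H ℤ.* q , P.trans (L H x y) (P.trans (P.cong (H ℤ.*_) e) (P.sym (ℤP.*-assoc H q mℤ)))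
        where L : ∀ H x y → H ℤ.* x ℤ.- H ℤ.* y ≡ H ℤ.* (x ℤ.- y)
              L = solve-∀

      α-kill : ∀ q → α (q ℤ.* c) ≈ + 0
      α-kill q = q ℤ.* c' , P.trans (L H q c) (P.trans (P.cong (q ℤ.*_) cH≡c'm) (P.sym (ℤP.*-assoc q c' mℤ)))
        where L : ∀ H q c → H ℤ.* (q ℤ.* c) ℤ.- + 0 ≡ q ℤ.* (c ℤ.* H)
              L = solve-∀

      α-into : ∀ x → c ℤ.* α x ≈ + 0
      α-into x = c' ℤ.* x , P.trans (L c H x) (P.trans (P.cong (ℤ._* x) cH≡c'm) (L2 c' mℤ x))
        where L : ∀ c H x → c ℤ.* (H ℤ.* x) ℤ.- + 0 ≡ (c ℤ.* H) ℤ.* x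
              L = solve-∀
              L2 : ∀ c M x → (c ℤ.* M) ℤ.* x ≡ (c ℤ.* x) ℤ.* M
              L2 = solve-∀

      α-onto : ∀ y → c ℤ.* y ≈ + 0 → ∃ λ x → α x ≈ y
      α-onto y cy≈0 = proj₁ (annihilated⇒H∣ {y} cy≈0) , ≡⇒≈ (P.sym (proj₂ (annihilated⇒H∣ {y} cy≈0)))

      β-cong : ∀ {y y'} → c ℤ.* y ≈ + 0 → c ℤ.* y' ≈ + 0 → y ≈ y' → ∃ λ q → β y ℤ.- β y' ≈ q ℤ.* c
      β-cong {y} {y'} cy cy' (r , y-y'≡rm) = multiple-of-g (β y ℤ.- β y') r
          (P.trans (P.cong₂ ℤ._-_ (β-H a y≡Ha) (β-H a' y'≡Ha')) (ℤP.*-cancelʳ-≡ (a ℤ.- a') (r ℤ.* + g) H [a-a']H≡))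
        where
          a = proj₁ (annihilated⇒H∣ cy)
          y≡Ha = proj₂ (annihilated⇒H∣ cy)
          a' = proj₁ (annihilated⇒H∣ cy')
          y'≡Ha' = proj₂ (annihilated⇒H∣ cy')
          [a-a']H≡ : (a ℤ.- a') ℤ.* H ≡ (r ℤ.* + g) ℤ.* H
          [a-a']H≡ = P.trans (L a a' H) (P.trans (P.sym (P.cong₂ ℤ._-_ y≡Ha y'≡Ha'))
                       (P.trans y-y'≡rm (P.trans (P.cong (r ℤ.*_) m≡Hg) (L2 r H (+ g)))))
            where L : ∀ a a' H → (a ℤ.- a') ℤ.* H ≡ H ℤ.* a ℤ.- H ℤ.* a'
                  L = solve-∀
                  L2 : ∀ r H g → r ℤ.* (H ℤ.* g) ≡ (r ℤ.* g) ℤ.* H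
                  L2 = solve-∀

      β-+ : ∀ {y y'} → c ℤ.* y ≈ + 0 → c ℤ.* y' ≈ + 0 → ∃ λ q → β (y ℤ.+ y') ℤ.- (β y ℤ.+ β y') ≈ q ℤ.* c
      β-+ {y} {y'} cy cy' = zero-multiple _
        (P.trans (P.cong₂ ℤ._-_ (β-H (a ℤ.+ a') (P.trans (P.cong₂ ℤ._+_ y≡Ha y'≡Ha') (P.sym (ℤP.*-distribˡ-+ H a a'))))
                                (P.cong₂ ℤ._+_ (β-H a y≡Ha) (β-H a' y'≡Ha')))
                 (ℤP.+-inverseʳ (a ℤ.+ a')))
        where
          a = proj₁ (annihilated⇒H∣ cy)
          y≡Ha = proj₂ (annihilated⇒H∣ cy)
          a' = proj₁ (annihilated⇒H∣ cy')
          y'≡Ha' = proj₂ (annihilated⇒H∣ cy')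

      β-* : ∀ b {y} → c ℤ.* y ≈ + 0 → ∃ λ q → β (b ℤ.* y) ℤ.- b ℤ.* β y ≈ q ℤ.* c
      β-* b {y} cy = zero-multiple _
        (P.trans (P.cong₂ ℤ._-_ (β-H (b ℤ.* a) (P.trans (P.cong (b ℤ.*_) y≡Ha) (P.sym (H-comm b a))))
                                (P.cong (b ℤ.*_) (β-H a y≡Ha)))
                 (ℤP.+-inverseʳ (b ℤ.* a)))
        where
          a = proj₁ (annihilated⇒H∣ cy)
          y≡Ha = proj₂ (annihilated⇒H∣ cy)

      β-onto : ∀ x → ∃ λ y → (c ℤ.* y ≈ + 0) × (∃ λ q → β y ℤ.- x ≈ q ℤ.* c)
      β-onto x = H ℤ.* x , α-into x , zero-multiple _ (P.trans (P.cong (ℤ._- x) (β-H x P.refl)) (ℤP.+-inverseʳ x))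

    annihilators : ∀ c → AnnData c
    annihilators c = record
      { α = α ; β = β
      ; α-cong = λ {x} {y} → α-cong {x} {y} ; α-+ = λ x y → ≡⇒≈ (ℤP.*-distribˡ-+ H x y) ; α-* = λ a x → ≡⇒≈ (H-comm a x)
      ; α-kill = α-kill ; α-into = α-into ; α-onto = α-onto
      ; β-cong = λ {y} {y'} → β-cong {y} {y'} ; β-+ = λ {y} {y'} → β-+ {y} {y'} ; β-* = λ b {y} → β-* b {y} ; β-onto = β-onto }
      where open Annihilator c

-- Proposition 3: r(H_A) = r_s(A) = r(⟨A_{r,s}⟩) - 1, for F = ℤ/mℤ or ℚ.
proposition3 :
    (Fc : FieldChoice) → let open Setup (Ring Fc) in
    ∀ {m ℓm} (M : Module (Ring Fc) m ℓm) →
    (s : ℕ) → 1 ≤ s →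
    (n : ℕ) (a : Fin (suc n) → Module.Carrierᴹ M) →
    (∀ i j → Module._≈ᴹ_ M (a i) (a j) → i ≡ j) →
    let open WithModule.WithSetSuc M s a in
    (rH rA rHom : ℕ) →
    HasRank _~_ InH rH →
    HasRank _~_ InAgen rA →
    HasRank _≈v_ IsFreimanHom rHom →
    (rH ≡ rHom ∸ 1) × (rH ≡ rA ∸ 1)
proposition3 ℚ M s _ n a _ =
  Main.rank-identities (Ring ℚ) Rationals.euclidean Rationals.annihilators M s n a
proposition3 (ℤ/ ℕ.zero ℤ ()) M s _ n a _
proposition3 (ℤ/ suc m' ℤ _) M s _ n a _ =
  Main.rank-identities (ZMod.commutativeRing (suc m')) (Modulus.euclidean m') (Modulus.annihilators m') M s n a
  where open IntegersMod using (module Modulus)
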